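{- Let $q$ be a prime power and $\ell$ an odd prime dividing $q-1$. For $n \ge 1$ let $N_q(n)$ denote the number of monic irreducible polynomials of degree $n$ in $\mathbb{F}_q[x]$. Then for every integer $t \ge 0$, $v_\ell(N_q(2^t\ell)) = v_\ell(q-1) - 1$.
   Context: For a prime $\ell$ and nonzero integer $n$, $v_\ell(n)$ is the exponent of the highest power of $\ell$ dividing $n$. -}

module Defs where

open import Level using (0ℓ)
open import Algebra.Bundles using (CommutativeRing)
open import Data.Nat using (ℕ; suc; _+_; _^_; _≤_)
open import Data.Nat.Divisibility using (_∣_)
open import Data.Fin using (Fin)
open import Data.Vec using (Vec; toList; map)
open import Data.List using (List; []; _∷_; _++_; length)
import Data.List as L
open import Data.List.Relation.Binary.Pointwise using (Pointwise)
open import Data.List.Membership.Propositional using (_∈_)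
open import Data.List.Relation.Unary.Unique.Propositional using (Unique)
open import Data.Product using (Σ; _×_; ∃)
open import Relation.Nullary using (¬_)
open import Relation.Binary.PropositionalEquality using (_≡_)

Valuation : ℕ → ℕ → ℕ → Set
Valuation ℓ n k = (ℓ ^ k ∣ n) × ¬ (ℓ ^ suc k ∣ n)

-- A finite field with exactly q elements: a commutative ring (setoid equality ≈)
-- with 1 ≉ 0, inverses of nonzero elements, and an enumeration Fin q ≅ Carrier (up to ≈).
record FiniteField (q : ℕ) : Set₁ where
  field
    commRing : CommutativeRing 0ℓ 0ℓ
  open CommutativeRing commRing public
  field
    1≉0     : ¬ (1# ≈ 0#)
    inverse : ∀ x → ¬ (x ≈ 0#) → Σ Carrier λ y → (x * y) ≈ 1#
    enum    : Fin q → Carrier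
    enum-injective  : ∀ i j → enum i ≈ enum j → i ≡ j
    enum-surjective : ∀ x → Σ (Fin q) λ i → x ≈ enum i

module Poly {q : ℕ} (F : FiniteField q) where
  open FiniteField F using (Carrier; _≈_; 0#; 1#; enum)
    renaming (_+_ to _+F_; _*_ to _*F_)

  -- polynomials as coefficient lists, lowest degree first
  addP : List Carrier → List Carrier → List Carrier
  addP [] g = g
  addP (a ∷ f) [] = a ∷ f
  addP (a ∷ f) (b ∷ g) = (a +F b) ∷ addP f g

  mulP : List Carrier → List Carrier → List Carrier
  mulP [] g = []
  mulP (a ∷ f) g = addP (L.map (a *F_) g) (0# ∷ mulP f g)

  _≈P_ : List Carrier → List Carrier → Set
  _≈P_ = Pointwise _≈_

  -- the monic polynomial of degree n with lower coefficients v : x^n + v_{n-1} x^{n-1} + … + v_0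
  monic : ∀ {n} → Vec Carrier n → List Carrier
  monic v = toList v ++ (1# ∷ [])

  Irreducible : ∀ n → Vec Carrier n → Set
  Irreducible n v =
    (1 ≤ n) ×
    ¬ (Σ ℕ λ i → Σ ℕ λ j → (1 ≤ i) × (1 ≤ j) ×
        Σ (i + j ≡ n) λ _ → Σ (Vec Carrier i) λ a → Σ (Vec Carrier j) λ b →
          mulP (monic a) (monic b) ≈P monic v)

  IrredCode : ∀ n → Vec (Fin q) n → Set
  IrredCode n c = Irreducible n (map enum c)

  CountsIrreducible : ℕ → ℕ → Set
  CountsIrreducible n N =
    Σ (List (Vec (Fin q) n)) λ xs →
      Unique xs × (∀ c → c ∈ xs → IrredCode n c) × (∀ c → IrredCode n c → c ∈ xs)
      × (length xs ≡ N)

module Submission where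

-- Every monic f of degree n factors into irreducibles, so deg f equals the
-- number of pairs (P, k) with P^k ∣ f weighted by deg P.  Summing over the q^n monic f
-- of degree n, and using that q^(n - k·d) of them are divisible by a fixed P^k of degree
-- k·d, gives  n·q^n = Σ_d d·N(d)·Σ_k q^(n-kd)  (Counting.weighted-count).  Comparing
-- n and n + 1 yields Gauss' formula  Σ_{d ∣ n} d·N(d) = q^n  (DivisorSums.counting⇒gauss).
--
-- Inclusion–exclusion over the divisors of ℓ and of 2T·ℓ (T = 2^t) gives
--   ℓ·N(ℓ) = q^ℓ - q   and   2Tℓ·N(2Tℓ) = (b^ℓ)² - b^ℓ - b² + b   with b = q^T.
-- Writing c^ℓ = c + W where v_ℓ(W) = v_ℓ(c - 1) (lifting the exponent, Valuations),
-- both right-hand sides have ℓ-adic valuation exactly v_ℓ(q - 1) (GaussToValuation).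

module Valuations where

  open import Defs using (Valuation)
  open import Data.Nat
  open import Data.Nat.Properties
  open import Data.Nat.Divisibility
  open import Data.Nat.Primality
  open import Data.Nat.Coprimality using (Coprime)
  open import Data.Product using (Σ; _×_; _,_; ∃)
  open import Data.Sum using (inj₁; inj₂)
  open import Data.Empty using (⊥-elim)
  open import Relation.Nullary using (¬_)
  open import Relation.Binary.PropositionalEquality
  open import Data.Nat.Tactic.RingSolver using (solve-∀)
  open ≡-Reasoning

  prime∤⇒coprime : ∀ {p d} → Prime p → ¬ p ∣ d → Coprime d p
  prime∤⇒coprime pp p∤d (c∣d , c∣p) with prime⇒irreducible pp c∣p
  ... | inj₁ c≡1 = c≡1
  ... | inj₂ refl = ⊥-elim (p∤d c∣d)

  prime∤1 : ∀ {ℓ} → Prime ℓ → ¬ ℓ ∣ 1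
  prime∤1 pℓ ℓ∣1 = nonTrivial⇒≢1 {{prime⇒nonTrivial pℓ}} (∣1⇒≡1 ℓ∣1)

  prime∤1+mult : ∀ {ℓ y} → Prime ℓ → ℓ ∣ y → ¬ ℓ ∣ 1 + y
  prime∤1+mult {ℓ} {y} pℓ ℓ∣y ℓ∣1+y =
    prime∤1 pℓ (∣m+n∣m⇒∣n (subst (ℓ ∣_) (+-comm 1 y) ℓ∣1+y) ℓ∣y)

  odd-prime∤2^ : ∀ {ℓ} → Prime ℓ → ℓ ≢ 2 → ∀ t → ¬ ℓ ∣ 2 ^ t
  odd-prime∤2^ pℓ ℓ≢2 zero = prime∤1 pℓ
  odd-prime∤2^ pℓ ℓ≢2 (suc t) ℓ∣2^t+1 with euclidsLemma 2 (2 ^ t) pℓ ℓ∣2^t+1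
  ... | inj₂ ℓ∣2^t = odd-prime∤2^ pℓ ℓ≢2 t ℓ∣2^t
  ... | inj₁ ℓ∣2 with prime⇒irreducible prime[2] ℓ∣2
  ...   | inj₁ ℓ≡1 = nonTrivial⇒≢1 {{prime⇒nonTrivial pℓ}} ℓ≡1
  ...   | inj₂ ℓ≡2 = ℓ≢2 ℓ≡2

  ^∣-cancel-unit : ∀ {ℓ u y} → Prime ℓ → ¬ ℓ ∣ u → ∀ k → ℓ ^ k ∣ u * y → ℓ ^ k ∣ y
  ^∣-cancel-unit {y = y} pℓ ℓ∤u zero _ = 1∣ y
  ^∣-cancel-unit {ℓ} {u} {y} pℓ ℓ∤u (suc k) h
    with euclidsLemma u y pℓ (∣-trans (m∣m*n (ℓ ^ k)) h)
  ... | inj₁ ℓ∣u = ⊥-elim (ℓ∤u ℓ∣u)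
  ... | inj₂ (divides y′ refl) =
    subst (ℓ * ℓ ^ k ∣_) (*-comm ℓ y′) (*-monoʳ-∣ ℓ ℓ^k∣y′)
    where
    u*y≡ : u * (y′ * ℓ) ≡ ℓ * (u * y′)
    u*y≡ = trans (sym (*-assoc u y′ ℓ)) (*-comm (u * y′) ℓ)
    ℓ^k∣y′ : ℓ ^ k ∣ y′
    ℓ^k∣y′ = ^∣-cancel-unit pℓ ℓ∤u k
               (*-cancelˡ-∣ ℓ {{prime⇒nonZero pℓ}} (subst (ℓ * ℓ ^ k ∣_) u*y≡ h))

  val-*-unit : ∀ {ℓ u y k} → Prime ℓ → ¬ ℓ ∣ u → Valuation ℓ y k → Valuation ℓ (u * y) k
  val-*-unit {u = u} {k = k} pℓ ℓ∤u (ℓ^k∣y , ℓ^k+1∤y) =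
    ∣n⇒∣m*n u ℓ^k∣y , λ h → ℓ^k+1∤y (^∣-cancel-unit pℓ ℓ∤u (suc k) h)

  val-*-unit⁻ : ∀ {ℓ u y k} → Prime ℓ → ¬ ℓ ∣ u → Valuation ℓ (u * y) k → Valuation ℓ y k
  val-*-unit⁻ {u = u} {k = k} pℓ ℓ∤u (ℓ^k∣uy , ℓ^k+1∤uy) =
    ^∣-cancel-unit pℓ ℓ∤u k ℓ^k∣uy , λ h → ℓ^k+1∤uy (∣n⇒∣m*n u h)

  val-divide : ∀ {ℓ N e} → Prime ℓ → Valuation ℓ (ℓ * N) e → Valuation ℓ N (e ∸ 1)
  val-divide {ℓ} {N} {zero} pℓ (_ , ℓ∤ℓN) =
    ⊥-elim (ℓ∤ℓN (subst (_∣ ℓ * N) (sym (*-identityʳ ℓ)) (m∣m*n N)))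
  val-divide {ℓ} {N} {suc e} pℓ (ℓ^e+1∣ℓN , ℓ^e+2∤ℓN) =
    *-cancelˡ-∣ ℓ {{prime⇒nonZero pℓ}} ℓ^e+1∣ℓN , λ h → ℓ^e+2∤ℓN (*-monoʳ-∣ ℓ h)

  geom : ℕ → ℕ → ℕ
  geom zero y = 0
  geom (suc m) y = (1 + y) ^ m + geom m y

  pow-geom : ∀ m y → (1 + y) ^ m ≡ 1 + y * geom m y
  pow-geom zero y = cong suc (sym (*-zeroʳ y))
  pow-geom (suc m) y = begin
    (1 + y) * (1 + y) ^ m            ≡⟨ cong ((1 + y) *_) (pow-geom m y) ⟩
    (1 + y) * (1 + y * geom m y)     ≡⟨ expand y (geom m y) ⟩
    1 + y * (1 + y * geom m y) + y * geom m y
                                     ≡⟨ cong (λ z → 1 + y * z + y * geom m y) (sym (pow-geom m y)) ⟩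
    1 + y * (1 + y) ^ m + y * geom m y
                                     ≡⟨ cong suc (sym (*-distribˡ-+ y ((1 + y) ^ m) (geom m y))) ⟩
    1 + y * ((1 + y) ^ m + geom m y) ∎
    where
    expand : ∀ y g → (1 + y) * (1 + y * g) ≡ 1 + y * (1 + y * g) + y * g
    expand = solve-∀

  -- When ℓ ∣ y, every term of G m y is ≡ 1, so G m y ≡ m (mod ℓ).
  geom-mod : ∀ {ℓ} m y → ℓ ∣ y → ∃ λ k → geom m y ≡ m + k * ℓ
  geom-mod zero y _ = 0 , refl
  geom-mod {ℓ} (suc m) y ℓ∣y@(divides j refl) with geom-mod m y ℓ∣y
  ... | k , G≡ = j * geom m y + k , (begin
    (1 + j * ℓ) ^ m + geom m y              ≡⟨ cong (_+ geom m y) (pow-geom m (j * ℓ)) ⟩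
    1 + j * ℓ * geom m y + geom m y         ≡⟨ cong (1 + j * ℓ * geom m y +_) G≡ ⟩
    1 + j * ℓ * geom m y + (m + k * ℓ)      ≡⟨ regroup j ℓ m k (geom m y) ⟩
    suc m + (j * geom m y + k) * ℓ          ∎)
    where
    regroup : ∀ j ℓ m k g → 1 + j * ℓ * g + (m + k * ℓ) ≡ suc m + (j * g + k) * ℓ
    regroup = solve-∀

  record NearOne (ℓ e c : ℕ) : Set where
    constructor nearOne
    field
      excess    : ℕ
      c≡1+      : c ≡ 1 + excess
      ℓ∣excess  : ℓ ∣ excess
      val       : Valuation ℓ excess e

  NearOne⇒∤ : ∀ {ℓ e c} → Prime ℓ → NearOne ℓ e c → ¬ ℓ ∣ c
  NearOne⇒∤ pℓ (nearOne z refl ℓ∣z _) = prime∤1+mult pℓ ℓ∣z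

  lift-exponent : ∀ {ℓ e c} m → Prime ℓ → ¬ ℓ ∣ m → NearOne ℓ e c → NearOne ℓ e (c ^ m)
  lift-exponent {ℓ} {e} m pℓ ℓ∤m (nearOne y refl ℓ∣y vy) =
    nearOne (y * geom m y) (pow-geom m y) (∣m⇒∣m*n (geom m y) ℓ∣y)
      (subst (λ z → Valuation ℓ z e) (*-comm (geom m y) y) (val-*-unit {ℓ} {geom m y} {y} {e} pℓ ℓ∤G vy))
    where
    ℓ∤G : ¬ ℓ ∣ geom m y
    ℓ∤G ℓ∣G with geom-mod m y ℓ∣y
    ... | k , G≡ = ℓ∤m (∣m+n∣m⇒∣n (subst (ℓ ∣_) (trans G≡ (+-comm m (k * ℓ))) ℓ∣G) (n∣m*n k))

  prime≥2 : ∀ {ℓ} → Prime ℓ → 2 ≤ ℓ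
  prime≥2 {ℓ} pℓ = nonTrivial⇒n>1 ℓ {{prime⇒nonTrivial pℓ}}

  prime∤pred : ∀ {ℓ} → Prime ℓ → ¬ ℓ ∣ ℓ ∸ 1
  prime∤pred pℓ ℓ∣ℓ-1 with prime≥2 pℓ
  ... | s≤s (s≤s {n = k} _) = <⇒≱ (n<1+n (suc k)) (∣⇒≤ ℓ∣ℓ-1)

  -- c^ℓ = c + W with v_ℓ(W) = v_ℓ(c - 1): apply lifting the exponent to c^(ℓ-1).
  frobenius-step : ∀ {ℓ e c} → Prime ℓ → NearOne ℓ e c →
    Σ ℕ λ W → (c ^ ℓ ≡ c + W) × ℓ ∣ W × Valuation ℓ W e
  frobenius-step {ℓ} {e} {c} pℓ nc with lift-exponent (ℓ ∸ 1) pℓ (prime∤pred pℓ) nc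
  ... | nearOne z c^ℓ-1≡1+z ℓ∣z vz =
    c * z , c^ℓ≡ , ∣n⇒∣m*n c ℓ∣z , val-*-unit {ℓ} {c} {z} {e} pℓ (NearOne⇒∤ pℓ nc) vz
    where
    c^ℓ≡ : c ^ ℓ ≡ c + c * z
    c^ℓ≡ = begin
      c ^ ℓ               ≡⟨ cong (c ^_) (sym (m+[n∸m]≡n (≤-trans (n≤1+n 1) (prime≥2 pℓ)))) ⟩
      c * c ^ (ℓ ∸ 1)     ≡⟨ cong (c *_) c^ℓ-1≡1+z ⟩
      c * (1 + z)         ≡⟨ *-distribˡ-+ c 1 z ⟩
      c * 1 + c * z       ≡⟨ cong (_+ c * z) (*-identityʳ c) ⟩
      c + c * z           ∎

  val-from-ℓ-identity : ∀ {ℓ e c N} → Prime ℓ → NearOne ℓ e c →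
    ℓ * N + c ≡ c ^ ℓ → Valuation ℓ N (e ∸ 1)
  val-from-ℓ-identity {ℓ} {e} {c} {N} pℓ nc identity with frobenius-step pℓ nc
  ... | W , c^ℓ≡ , _ , vW = val-divide {e = e} pℓ (subst (λ x → Valuation ℓ x e) (sym ℓN≡W) vW)
    where
    ℓN≡W : ℓ * N ≡ W
    ℓN≡W = +-cancelʳ-≡ c (ℓ * N) W (trans identity (trans c^ℓ≡ (+-comm c W)))

  solve-2ℓ-identity : ∀ X y W → X + (1 + y + W) + (1 + y) * (1 + y) ≡ (1 + y + W) * (1 + y + W) + (1 + y) →
    X ≡ (1 + (2 * y + W)) * W
  solve-2ℓ-identity X y W identity = +-cancelʳ-≡ (1 + y + W + (1 + y) * (1 + y)) X _ (begin
    X + (1 + y + W + (1 + y) * (1 + y))             ≡⟨ sym (+-assoc X _ _) ⟩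
    X + (1 + y + W) + (1 + y) * (1 + y)             ≡⟨ identity ⟩
    (1 + y + W) * (1 + y + W) + (1 + y)             ≡⟨ expand y W ⟩
    (1 + (2 * y + W)) * W + (1 + y + W + (1 + y) * (1 + y)) ∎)
    where
    expand : ∀ y W → (1 + y + W) * (1 + y + W) + (1 + y)
                   ≡ (1 + (2 * y + W)) * W + (1 + y + W + (1 + y) * (1 + y))
    expand = solve-∀

  -- If m·ℓ·N + c^ℓ + c² = (c^ℓ)² + c with ℓ ∤ m and c ≡ 1 (mod ℓ), then again
  -- v_ℓ(N) = v_ℓ(c - 1) - 1: with c^ℓ = c + W, m·ℓ·N = (2c - 1 + W)·W and 2c - 1 + W ≡ 1 (mod ℓ).
  val-from-2ℓ-identity : ∀ {ℓ e c m N} → Prime ℓ → NearOne ℓ e c → ¬ ℓ ∣ m →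
    m * ℓ * N + c ^ ℓ + c * c ≡ c ^ ℓ * c ^ ℓ + c → Valuation ℓ N (e ∸ 1)
  val-from-2ℓ-identity {ℓ} {e} {c} {m} {N} pℓ nc@(nearOne y refl ℓ∣y _) ℓ∤m identity
    with frobenius-step pℓ nc
  ... | W , c^ℓ≡ , ℓ∣W , vW =
    val-divide {e = e} pℓ (val-*-unit⁻ {k = e} pℓ ℓ∤m (subst (λ x → Valuation ℓ x e) (sym mℓN≡) vProduct))
    where
    factor = 1 + (2 * y + W)
    vProduct : Valuation ℓ (factor * W) e
    vProduct = val-*-unit {k = e} pℓ (prime∤1+mult pℓ (∣m∣n⇒∣m+n (∣n⇒∣m*n 2 ℓ∣y) ℓ∣W)) vW
    mℓN≡ : m * (ℓ * N) ≡ factor * W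
    mℓN≡ = trans (sym (*-assoc m ℓ N))
      (solve-2ℓ-identity (m * ℓ * N) y W (subst (λ C → m * ℓ * N + C + c * c ≡ C * C + c) c^ℓ≡ identity))

module DivisorSums where

  open Valuations using (prime∤⇒coprime; prime≥2; prime∤1)
  open import Data.Nat
  open import Data.Nat.Properties
  open import Data.Nat.Divisibility
  open import Data.Nat.Primality
  open import Data.Nat.Coprimality using (coprime-divisor; coprime-factors)
  open import Data.Product using (_×_; _,_)
  open import Data.Sum using (_⊎_; inj₁; inj₂)
  open import Data.Empty using (⊥-elim)
  open import Relation.Nullary using (¬_; yes; no; Dec)
  open import Relation.Nullary.Decidable using (_⊎-dec_)
  open import Relation.Binary.PropositionalEquality
  open import Relation.Binary.Definitions using (tri<; tri≈; tri>)
  open import Data.Nat.Tactic.RingSolver using (solve-∀)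
  open ≡-Reasoning

  sumTo : ℕ → (ℕ → ℕ) → ℕ
  sumTo zero f = 0
  sumTo (suc n) f = sumTo n f + f (suc n)

  sumTo-cong : ∀ n {f g : ℕ → ℕ} → (∀ d → 1 ≤ d → d ≤ n → f d ≡ g d) → sumTo n f ≡ sumTo n g
  sumTo-cong zero h = refl
  sumTo-cong (suc n) h =
    cong₂ _+_ (sumTo-cong n (λ d 1≤d d≤n → h d 1≤d (m≤n⇒m≤1+n d≤n))) (h (suc n) (s≤s z≤n) ≤-refl)

  sumTo-+ : ∀ n (f g : ℕ → ℕ) → sumTo n (λ d → f d + g d) ≡ sumTo n f + sumTo n g
  sumTo-+ zero f g = refl
  sumTo-+ (suc n) f g =
    trans (cong (_+ (f (suc n) + g (suc n))) (sumTo-+ n f g))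
          (swap (sumTo n f) (sumTo n g) (f (suc n)) (g (suc n)))
    where
    swap : ∀ a b c d → a + b + (c + d) ≡ a + c + (b + d)
    swap = solve-∀

  sumTo-*ˡ : ∀ n c (f : ℕ → ℕ) → sumTo n (λ d → c * f d) ≡ c * sumTo n f
  sumTo-*ˡ zero c f = sym (*-zeroʳ c)
  sumTo-*ˡ (suc n) c f =
    trans (cong (_+ c * f (suc n)) (sumTo-*ˡ n c f)) (sym (*-distribˡ-+ c (sumTo n f) (f (suc n))))

  sumTo-0 : ∀ n {f : ℕ → ℕ} → (∀ d → 1 ≤ d → d ≤ n → f d ≡ 0) → sumTo n f ≡ 0
  sumTo-0 n {f} h = trans (sumTo-cong n h) (zeros n)
    where
    zeros : ∀ n → sumTo n (λ _ → 0) ≡ 0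
    zeros zero = refl
    zeros (suc n) = cong (_+ 0) (zeros n)

  sumTo-extend : ∀ m n {f : ℕ → ℕ} → m ≤ n → (∀ d → m < d → f d ≡ 0) → sumTo n f ≡ sumTo m f
  sumTo-extend m n {f} m≤n h = trans (cong (λ k → sumTo k f) (sym (m∸n+n≡m m≤n))) (padded (n ∸ m))
    where
    padded : ∀ k → sumTo (k + m) f ≡ sumTo m f
    padded zero = refl
    padded (suc k) = trans (cong₂ _+_ (padded k) (h (suc (k + m)) (s≤s (m≤n+m m k)))) (+-identityʳ _)

  𝕀 : ∀ {P : Set} → Dec P → ℕ
  𝕀 (yes _) = 1
  𝕀 (no _) = 0

  𝕀-yes : ∀ {P : Set} → P → (p? : Dec P) → 𝕀 p? ≡ 1
  𝕀-yes p (yes _) = refl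
  𝕀-yes p (no ¬p) = ⊥-elim (¬p p)

  𝕀-no : ∀ {P : Set} → ¬ P → (p? : Dec P) → 𝕀 p? ≡ 0
  𝕀-no ¬p (yes p) = ⊥-elim (¬p p)
  𝕀-no ¬p (no _) = refl

  𝕀-cong : ∀ {A B : Set} → (A → B) → (B → A) → (a? : Dec A) (b? : Dec B) → 𝕀 a? ≡ 𝕀 b?
  𝕀-cong f g (yes a) b? = sym (𝕀-yes (f a) b?)
  𝕀-cong f g (no ¬a) b? = sym (𝕀-no (λ b → ¬a (g b)) b?)

  𝕀-disjoint : ∀ {A B C : Set} → ¬ (A × B) → (C → A ⊎ B) → (A → C) → (B → C) →
    (a? : Dec A) (b? : Dec B) (c? : Dec C) → 𝕀 c? ≡ 𝕀 a? + 𝕀 b?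
  𝕀-disjoint disj split fromA fromB (yes a) (yes b) c? = ⊥-elim (disj (a , b))
  𝕀-disjoint disj split fromA fromB (yes a) (no _) c? = 𝕀-yes (fromA a) c?
  𝕀-disjoint disj split fromA fromB (no _) (yes b) c? = 𝕀-yes (fromB b) c?
  𝕀-disjoint disj split fromA fromB (no ¬a) (no ¬b) c? =
    𝕀-no (λ c → neither (split c)) c?
    where
    neither : ¬ (_ ⊎ _)
    neither (inj₁ a) = ¬a a
    neither (inj₂ b) = ¬b b

  𝕀∣ : ℕ → ℕ → ℕ
  𝕀∣ d m = 𝕀 (d ∣? m)

  𝕀≡ : ℕ → ℕ → ℕ
  𝕀≡ d m = 𝕀 (d ≟ m)

  sumTo-delta : ∀ n (f : ℕ → ℕ) → 1 ≤ n → sumTo n (λ d → f d * 𝕀≡ d n) ≡ f n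
  sumTo-delta (suc n) f _ = cong₂ _+_
    (sumTo-0 n (λ d _ d≤n → trans (cong (f d *_) (𝕀-no (<⇒≢ (s≤s d≤n)) (d ≟ suc n))) (*-zeroʳ (f d))))
    (trans (cong (f (suc n) *_) (𝕀-yes refl (suc n ≟ suc n))) (*-identityʳ _))

  divisorSum : (ℕ → ℕ) → ℕ → ℕ
  divisorSum N m = sumTo m (λ d → d * N d * 𝕀∣ d m)

  divisorSum-extend : ∀ N m n → 1 ≤ m → m ≤ n → sumTo n (λ d → d * N d * 𝕀∣ d m) ≡ divisorSum N m
  divisorSum-extend N m n 1≤m m≤n = sumTo-extend m n m≤n (λ d m<d →
    trans (cong (d * N d *_) (𝕀-no (>⇒∤ {{>-nonZero 1≤m}} m<d) (d ∣? m))) (*-zeroʳ (d * N d)))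

  GaussFormula : ℕ → (ℕ → ℕ) → Set
  GaussFormula q N = ∀ m → 1 ≤ m → divisorSum N m ≡ q ^ m

  divisors-of-prime : ∀ {ℓ} d → Prime ℓ → 𝕀∣ d ℓ ≡ 𝕀≡ d ℓ + 𝕀∣ d 1
  divisors-of-prime {ℓ} d pℓ =
    𝕀-disjoint (λ { (refl , ℓ∣1) → prime∤1 pℓ ℓ∣1 }) split (λ { refl → ∣-refl })
               (λ d∣1 → ∣-trans d∣1 (1∣ ℓ)) (d ≟ ℓ) (d ∣? 1) (d ∣? ℓ)
    where
    split : d ∣ ℓ → d ≡ ℓ ⊎ d ∣ 1
    split d∣ℓ with prime⇒irreducible pℓ d∣ℓ
    ... | inj₁ refl = inj₂ ∣-refl
    ... | inj₂ d≡ℓ = inj₁ d≡ℓ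

  proper-divisor-of-prime-power : ∀ {p d} k → Prime p →
    d ∣ p * p ^ k → d ≢ p * p ^ k → d ∣ p ^ k
  proper-divisor-of-prime-power {p} {d} k pp d∣ d≢ with p ∣? d
  ... | no p∤d = coprime-divisor (prime∤⇒coprime pp p∤d) d∣
  proper-divisor-of-prime-power {p} zero pp d∣ d≢ | yes (divides d′ refl) =
    ⊥-elim (d≢ (∣-antisym d∣ (subst (_∣ d′ * p) (sym (*-identityʳ p)) (n∣m*n d′))))
  proper-divisor-of-prime-power {p} (suc k) pp d∣ d≢ | yes (divides d′ refl) =
    subst (_∣ p * p ^ k) (*-comm p d′) (*-monoʳ-∣ p d′∣p^k)
    where
    p≢0 = prime⇒nonZero pp
    d′∣p^k : d′ ∣ p ^ k
    d′∣p^k = proper-divisor-of-prime-power k pp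
      (*-cancelˡ-∣ p {{p≢0}} (subst (_∣ p * (p * p ^ k)) (*-comm d′ p) d∣))
      (λ d′≡ → d≢ (trans (*-comm d′ p) (cong (p *_) d′≡)))

  module DivisorsOf2Tℓ {ℓ : ℕ} (t : ℕ) (pℓ : Prime ℓ) (ℓ-odd : ¬ 2 ∣ ℓ) where

    T = 2 ^ t
    n = 2 * T * ℓ

    instance
      T≢0 : NonZero T
      T≢0 = >-nonZero (m^n>0 2 t)
      ℓ≢0 : NonZero ℓ
      ℓ≢0 = prime⇒nonZero pℓ

    2T≢0 : NonZero (2 * T)
    2T≢0 = >-nonZero (m^n>0 2 (suc t))

    Tℓ≢0 : NonZero (T * ℓ)
    Tℓ≢0 = m*n≢0 T ℓ

    Tℓ∣n : T * ℓ ∣ n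
    Tℓ∣n = subst (T * ℓ ∣_) (sym (*-assoc 2 T ℓ)) (n∣m*n 2)

    2T∣n : 2 * T ∣ n
    2T∣n = m∣m*n ℓ

    T∣Tℓ : T ∣ T * ℓ
    T∣Tℓ = m∣m*n ℓ

    Tℓ<n : T * ℓ < n
    Tℓ<n = *-monoˡ-< ℓ (subst (T <_) (*-comm T 2) (m<m*n T 2 ≤-refl))

    2T<n : 2 * T < n
    2T<n = m<m*n (2 * T) ℓ {{2T≢0}} (prime≥2 pℓ)

    T<n : T < n
    T<n = ≤-<-trans (m≤m*n T ℓ) Tℓ<n

    common-divisor : ∀ {d} → d ∣ T * ℓ → d ∣ 2 * T → d ∣ T
    common-divisor {d} d∣Tℓ d∣2T =
      coprime-factors (prime∤⇒coprime prime[2] ℓ-odd) (subst (d ∣_) (*-comm T ℓ) d∣Tℓ , d∣2T)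

    proper-divisor : ∀ {d} → d ∣ n → d ≢ n → d ∣ T * ℓ ⊎ d ∣ 2 * T
    proper-divisor {d} d∣n d≢n with ℓ ∣? d
    ... | no ℓ∤d = inj₂ (coprime-divisor (prime∤⇒coprime pℓ ℓ∤d) (subst (d ∣_) (*-comm (2 * T) ℓ) d∣n))
    ... | yes (divides d′ refl) = inj₁ (subst₂ _∣_ (*-comm ℓ d′) (*-comm ℓ T) (*-monoʳ-∣ ℓ d′∣T))
      where
      d′∣T : d′ ∣ T
      d′∣T = proper-divisor-of-prime-power t prime[2]
        (*-cancelˡ-∣ ℓ (subst₂ _∣_ (*-comm d′ ℓ) (*-comm (2 * T) ℓ) d∣n))
        (λ d′≡ → d≢n (cong (_* ℓ) d′≡))

    divisor-count : ∀ d → 𝕀∣ d n + 𝕀∣ d T ≡ 𝕀≡ d n + 𝕀∣ d (T * ℓ) + 𝕀∣ d (2 * T)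
    divisor-count d with d ∣? T
    ... | yes d∣T = begin
      𝕀∣ d n + 1
        ≡⟨ cong (_+ 1) (𝕀-yes (∣-trans d∣T (∣-trans T∣Tℓ Tℓ∣n)) (d ∣? n)) ⟩
      2
        ≡⟨ sym (cong₂ _+_ (cong₂ _+_ (𝕀-no d≢n (d ≟ n)) (𝕀-yes (∣-trans d∣T T∣Tℓ) (d ∣? T * ℓ)))
                                    (𝕀-yes (∣n⇒∣m*n 2 d∣T) (d ∣? 2 * T))) ⟩
      𝕀≡ d n + 𝕀∣ d (T * ℓ) + 𝕀∣ d (2 * T) ∎
      where
      d≢n : d ≢ n
      d≢n refl = <⇒≱ T<n (∣⇒≤ d∣T)
    ... | no d∤T = begin
      𝕀∣ d n + 0
        ≡⟨ +-identityʳ _ ⟩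
      𝕀∣ d n
        ≡⟨ 𝕀-disjoint (λ { (refl , n∣Tℓ⊎2T) → n∤ n∣Tℓ⊎2T }) (λ d∣n → split d∣n (d ≟ n))
                      (λ { refl → ∣-refl }) (λ { (inj₁ d∣Tℓ) → ∣-trans d∣Tℓ Tℓ∣n ; (inj₂ d∣2T) → ∣-trans d∣2T 2T∣n })
                      (d ≟ n) (d ∣? T * ℓ ⊎-dec d ∣? 2 * T) (d ∣? n) ⟩
      𝕀≡ d n + 𝕀 (d ∣? T * ℓ ⊎-dec d ∣? 2 * T)
        ≡⟨ cong (𝕀≡ d n +_) (𝕀-disjoint (λ (d∣Tℓ , d∣2T) → d∤T (common-divisor d∣Tℓ d∣2T)) (λ x → x) inj₁ inj₂
                                         (d ∣? T * ℓ) (d ∣? 2 * T) (d ∣? T * ℓ ⊎-dec d ∣? 2 * T)) ⟩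
      𝕀≡ d n + (𝕀∣ d (T * ℓ) + 𝕀∣ d (2 * T))
        ≡⟨ sym (+-assoc (𝕀≡ d n) _ _) ⟩
      𝕀≡ d n + 𝕀∣ d (T * ℓ) + 𝕀∣ d (2 * T) ∎
      where
      n∤ : ¬ (n ∣ T * ℓ ⊎ n ∣ 2 * T)
      n∤ (inj₁ n∣Tℓ) = >⇒∤ {{Tℓ≢0}} Tℓ<n n∣Tℓ
      n∤ (inj₂ n∣2T) = >⇒∤ {{2T≢0}} 2T<n n∣2T
      split : d ∣ n → Dec (d ≡ n) → d ≡ n ⊎ (d ∣ T * ℓ ⊎ d ∣ 2 * T)
      split d∣n (yes d≡n) = inj₁ d≡n
      split d∣n (no d≢n) = inj₂ (proper-divisor d∣n d≢n)

  module Weighted (N : ℕ → ℕ) (n : ℕ) where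

    Σw : (ℕ → ℕ) → ℕ
    Σw g = sumTo n (λ d → d * N d * g d)

    Σw-+ : ∀ g h → Σw (λ d → g d + h d) ≡ Σw g + Σw h
    Σw-+ g h = trans (sumTo-cong n (λ d _ _ → *-distribˡ-+ (d * N d) (g d) (h d))) (sumTo-+ n _ _)

    Σw-cong : ∀ {g h} → (∀ d → 1 ≤ d → g d ≡ h d) → Σw g ≡ Σw h
    Σw-cong g≡h = sumTo-cong n (λ d 1≤d _ → cong (d * N d *_) (g≡h d 1≤d))

    Σw-delta : 1 ≤ n → Σw (λ d → 𝕀≡ d n) ≡ n * N n
    Σw-delta = sumTo-delta n (λ d → d * N d)

    Σw-divisors : ∀ {q} m → GaussFormula q N → 1 ≤ m → m ≤ n → Σw (λ d → 𝕀∣ d m) ≡ q ^ m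
    Σw-divisors m gauss 1≤m m≤n = trans (divisorSum-extend N m n 1≤m m≤n) (gauss m 1≤m)

  gauss-at-prime : ∀ {q ℓ} N → GaussFormula q N → Prime ℓ → ℓ * N ℓ + q ≡ q ^ ℓ
  gauss-at-prime {q} {ℓ} N gauss pℓ = begin
    ℓ * N ℓ + q
      ≡⟨ cong₂ _+_ (sym (Σw-delta 1≤ℓ)) (sym (trans (Σw-divisors 1 gauss ≤-refl 1≤ℓ) (*-identityʳ q))) ⟩
    Σw (λ d → 𝕀≡ d ℓ) + Σw (λ d → 𝕀∣ d 1)
      ≡⟨ sym (Σw-+ _ _) ⟩
    Σw (λ d → 𝕀≡ d ℓ + 𝕀∣ d 1)
      ≡⟨ Σw-cong (λ d _ → sym (divisors-of-prime d pℓ)) ⟩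
    Σw (λ d → 𝕀∣ d ℓ)
      ≡⟨ Σw-divisors ℓ gauss 1≤ℓ ≤-refl ⟩
    q ^ ℓ ∎
    where
    open Weighted N ℓ
    1≤ℓ : 1 ≤ ℓ
    1≤ℓ = ≤-trans (n≤1+n 1) (prime≥2 pℓ)

  gauss-at-2Tℓ : ∀ {q ℓ} t N → GaussFormula q N → Prime ℓ → ¬ 2 ∣ ℓ →
    let T = 2 ^ t ; n = 2 * T * ℓ in
    n * N n + q ^ (T * ℓ) + q ^ (2 * T) ≡ q ^ n + q ^ T
  gauss-at-2Tℓ {q} {ℓ} t N gauss pℓ ℓ-odd = begin
    n * N n + q ^ (T * ℓ) + q ^ (2 * T)
      ≡⟨ cong₂ _+_ (cong₂ _+_ (sym (Σw-delta 1≤n)) (sym (Σw-divisors (T * ℓ) gauss 1≤Tℓ Tℓ≤n)))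
                   (sym (Σw-divisors (2 * T) gauss 1≤2T 2T≤n)) ⟩
    Σw (λ d → 𝕀≡ d n) + Σw (λ d → 𝕀∣ d (T * ℓ)) + Σw (λ d → 𝕀∣ d (2 * T))
      ≡⟨ cong (_+ Σw (λ d → 𝕀∣ d (2 * T))) (sym (Σw-+ _ _)) ⟩
    Σw (λ d → 𝕀≡ d n + 𝕀∣ d (T * ℓ)) + Σw (λ d → 𝕀∣ d (2 * T))
      ≡⟨ sym (Σw-+ _ _) ⟩
    Σw (λ d → 𝕀≡ d n + 𝕀∣ d (T * ℓ) + 𝕀∣ d (2 * T))
      ≡⟨ Σw-cong (λ d _ → sym (divisor-count d)) ⟩
    Σw (λ d → 𝕀∣ d n + 𝕀∣ d T)
      ≡⟨ Σw-+ _ _ ⟩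
    Σw (λ d → 𝕀∣ d n) + Σw (λ d → 𝕀∣ d T)
      ≡⟨ cong₂ _+_ (Σw-divisors n gauss 1≤n ≤-refl) (Σw-divisors T gauss 1≤T (<⇒≤ T<n)) ⟩
    q ^ n + q ^ T ∎
    where
    open DivisorsOf2Tℓ t pℓ ℓ-odd
    open Weighted N n
    1≤T : 1 ≤ T
    1≤T = m^n>0 2 t
    1≤Tℓ : 1 ≤ T * ℓ
    1≤Tℓ = >-nonZero⁻¹ (T * ℓ) {{Tℓ≢0}}
    1≤2T : 1 ≤ 2 * T
    1≤2T = m^n>0 2 (suc t)
    1≤n : 1 ≤ n
    1≤n = ≤-<-trans z≤n T<n
    Tℓ≤n : T * ℓ ≤ n
    Tℓ≤n = <⇒≤ Tℓ<n
    2T≤n : 2 * T ≤ n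
    2T≤n = <⇒≤ 2T<n

  -- #{monic f of degree n divisible by a fixed monic g of degree e}  =  q^(n-e) if e ≤ n, else 0.
  multiples : ℕ → ℕ → ℕ → ℕ
  multiples q n e = count (e ≤? n)
    where
    count : Dec (e ≤ n) → ℕ
    count (yes _) = q ^ (n ∸ e)
    count (no _) = 0

  multiples-≤ : ∀ q n e → e ≤ n → multiples q n e ≡ q ^ (n ∸ e)
  multiples-≤ q n e e≤n with e ≤? n
  ... | yes _ = refl
  ... | no e≰n = ⊥-elim (e≰n e≤n)

  multiples-> : ∀ q n e → ¬ e ≤ n → multiples q n e ≡ 0
  multiples-> q n e e≰n with e ≤? n
  ... | yes e≤n = ⊥-elim (e≰n e≤n)
  ... | no _ = refl

  multiples-suc : ∀ q n e → multiples q (suc n) e ≡ q * multiples q n e + 𝕀≡ e (suc n)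
  multiples-suc q n e with <-cmp e (suc n)
  ... | tri< e<1+n _ _ = begin
    multiples q (suc n) e        ≡⟨ multiples-≤ q (suc n) e (<⇒≤ e<1+n) ⟩
    q ^ (suc n ∸ e)              ≡⟨ cong (q ^_) (+-∸-assoc 1 (≤-pred e<1+n)) ⟩
    q * q ^ (n ∸ e)              ≡⟨ sym (+-identityʳ _) ⟩
    q * q ^ (n ∸ e) + 0          ≡⟨ cong₂ (λ a b → q * a + b) (sym (multiples-≤ q n e (≤-pred e<1+n)))
                                                            (sym (𝕀-no (<⇒≢ e<1+n) (e ≟ suc n))) ⟩
    q * multiples q n e + 𝕀≡ e (suc n) ∎
  ... | tri≈ _ refl _ = begin
    multiples q (suc n) (suc n)  ≡⟨ multiples-≤ q (suc n) (suc n) ≤-refl ⟩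
    q ^ (n ∸ n)                  ≡⟨ cong (q ^_) (n∸n≡0 n) ⟩
    1                            ≡⟨ cong (_+ 1) (sym (*-zeroʳ q)) ⟩
    q * 0 + 1                    ≡⟨ sym (cong₂ (λ a b → q * a + b) (multiples-> q n (suc n) (<⇒≱ (n<1+n n)))
                                                                   (𝕀-yes refl (suc n ≟ suc n))) ⟩
    q * multiples q n (suc n) + 𝕀≡ (suc n) (suc n) ∎
  ... | tri> _ _ e>1+n = begin
    multiples q (suc n) e        ≡⟨ multiples-> q (suc n) e (<⇒≱ e>1+n) ⟩
    0                            ≡⟨ cong (_+ 0) (sym (*-zeroʳ q)) ⟩
    q * 0 + 0                    ≡⟨ sym (cong₂ (λ a b → q * a + b) (multiples-> q n e (λ e≤n → <⇒≱ e>1+n (m≤n⇒m≤1+n e≤n)))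
                                                                   (𝕀-no (λ e≡ → <⇒≢ e>1+n (sym e≡)) (e ≟ suc n))) ⟩
    q * multiples q n e + 𝕀≡ e (suc n) ∎

  sumTo-multiple-of : ∀ M d m → 1 ≤ d → 1 ≤ m → m ≤ M → sumTo M (λ k → 𝕀≡ (k * d) m) ≡ 𝕀∣ d m
  sumTo-multiple-of M d m 1≤d 1≤m m≤M with d ∣? m
  ... | no d∤m = sumTo-0 M (λ k _ _ → 𝕀-no (λ kd≡m → d∤m (divides k (sym kd≡m))) (k * d ≟ m))
  ... | yes (divides c refl) = begin
    sumTo M (λ k → 𝕀≡ (k * d) (c * d)) ≡⟨ sumTo-cong M (λ k _ _ → 𝕀-cong (*-cancelʳ-≡ k c d) (cong (_* d)) _ _) ⟩
    sumTo M (λ k → 𝕀≡ k c)             ≡⟨ sumTo-extend c M c≤M (λ k c<k → 𝕀-no (λ k≡c → <⇒≢ c<k (sym k≡c)) (k ≟ c)) ⟩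
    sumTo c (λ k → 𝕀≡ k c)             ≡⟨ sumTo-cong c (λ k _ _ → sym (*-identityˡ (𝕀≡ k c))) ⟩
    sumTo c (λ k → 1 * 𝕀≡ k c)         ≡⟨ sumTo-delta c (λ _ → 1) 1≤c ⟩
    1 ∎
    where
    instance
      d≢0 : NonZero d
      d≢0 = >-nonZero 1≤d
    1≤c : 1 ≤ c
    1≤c = >-nonZero⁻¹ c {{m*n≢0⇒m≢0 c {{>-nonZero 1≤m}}}}
    c≤M : c ≤ M
    c≤M = ≤-trans (m≤m*n c d) m≤M

  -- Σ_{d ≤ M} d · N(d) · Σ_{k ≤ M} multiples q n (k·d): the total multiplicity count of
  -- prime powers dividing the monic polynomials of degree n.
  weightedCount : ℕ → (ℕ → ℕ) → ℕ → ℕ → ℕ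
  weightedCount q N M n = sumTo M (λ d → d * (N d * sumTo M (λ k → multiples q n (k * d))))

  -- From  n·q^n = weightedCount q N M n  (for n ≤ M) to Gauss' formula:
  -- the count for n + 1 is q times the count for n plus the divisor sum at n + 1.
  counting⇒gauss : ∀ q N → (∀ M n → n ≤ M → n * q ^ n ≡ weightedCount q N M n) → GaussFormula q N
  counting⇒gauss q N count (suc n) _ = +-cancelˡ-≡ (q * (n * q ^ n)) _ _ (begin
    q * (n * q ^ n) + divisorSum N M
      ≡⟨ cong₂ _+_ (cong (q *_) (count M n (n≤1+n n))) (sym exact-multiples) ⟩
    q * weightedCount q N M n + sumTo M (λ d → d * (N d * sumTo M (λ k → 𝕀≡ (k * d) M)))
      ≡⟨ cong (_+ sumTo M (λ d → d * (N d * sumTo M (λ k → 𝕀≡ (k * d) M)))) (sym (sumTo-*ˡ M q _)) ⟩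
    sumTo M (λ d → q * (d * (N d * old d))) + sumTo M (λ d → d * (N d * sumTo M (λ k → 𝕀≡ (k * d) M)))
      ≡⟨ sym (sumTo-+ M _ _) ⟩
    sumTo M (λ d → q * (d * (N d * old d)) + d * (N d * sumTo M (λ k → 𝕀≡ (k * d) M)))
      ≡⟨ sumTo-cong M (λ d _ _ → trans (regroup q d (N d) _ _) (cong (λ z → d * (N d * z)) (sym (inner-step d)))) ⟩
    weightedCount q N M M
      ≡⟨ sym (count M M ≤-refl) ⟩
    M * q ^ M
      ≡⟨ split-power n (q ^ n) q ⟩
    q * (n * q ^ n) + q ^ M ∎)
    where
    M = suc n
    old : ℕ → ℕ
    old d = sumTo M (λ k → multiples q n (k * d))
    regroup : ∀ q d N A B → q * (d * (N * A)) + d * (N * B) ≡ d * (N * (q * A + B))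
    regroup = solve-∀
    split-power : ∀ n Q q → suc n * (q * Q) ≡ q * (n * Q) + q * Q
    split-power = solve-∀
    inner-step : ∀ d → sumTo M (λ k → multiples q M (k * d)) ≡ q * old d + sumTo M (λ k → 𝕀≡ (k * d) M)
    inner-step d = trans (sumTo-cong M (λ k _ _ → multiples-suc q n (k * d)))
                         (trans (sumTo-+ M _ _) (cong (_+ sumTo M (λ k → 𝕀≡ (k * d) M)) (sumTo-*ˡ M q _)))
    exact-multiples : sumTo M (λ d → d * (N d * sumTo M (λ k → 𝕀≡ (k * d) M))) ≡ divisorSum N M
    exact-multiples = sumTo-cong M (λ d 1≤d _ →
      trans (cong (λ z → d * (N d * z)) (sumTo-multiple-of M d M 1≤d (s≤s z≤n) ≤-refl)) (sym (*-assoc d (N d) _)))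

module ListSums where

  open DivisorSums using (sumTo; 𝕀; 𝕀-yes; 𝕀-no)
  open import Data.Nat
  open import Data.Nat.Properties
  open import Data.List using (List; []; _∷_; map; length; filter; cartesianProductWith)
  open import Data.List.Properties using (length-map; length-++)
  open import Data.List.Membership.Propositional using (_∈_)
  open import Data.List.Membership.Propositional.Properties.WithK using (unique∧set⇒bag)
  open import Data.List.Relation.Binary.BagAndSetEquality using (∼bag⇒↭)
  open import Data.List.Relation.Binary.Permutation.Propositional.Properties using (↭-length)
  open import Data.List.Relation.Unary.Any using (here; there)
  open import Data.List.Relation.Unary.All using (_∷_)
  open import Data.List.Relation.Unary.All.Properties using (All¬⇒¬Any)
  open import Data.List.Relation.Unary.Unique.Propositional using (Unique)
  open import Data.List.Relation.Unary.AllPairs using (_∷_)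
  open import Function.Bundles using (mk⇔)
  open import Relation.Nullary using (yes; no)
  open import Relation.Unary using (Pred; Decidable)
  open import Relation.Binary.Definitions using (DecidableEquality)
  open import Relation.Binary.PropositionalEquality
  open import Data.Nat.Tactic.RingSolver using (solve-∀)

  listSum : ∀ {A : Set} → List A → (A → ℕ) → ℕ
  listSum [] f = 0
  listSum (x ∷ xs) f = f x + listSum xs f

  listSum-cong : ∀ {A : Set} (xs : List A) {f g : A → ℕ} → (∀ x → x ∈ xs → f x ≡ g x) →
    listSum xs f ≡ listSum xs g
  listSum-cong [] f≡g = refl
  listSum-cong (x ∷ xs) f≡g = cong₂ _+_ (f≡g x (here refl)) (listSum-cong xs (λ y y∈ → f≡g y (there y∈)))

  listSum-const : ∀ {A : Set} (xs : List A) c → listSum xs (λ _ → c) ≡ length xs * c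
  listSum-const [] c = refl
  listSum-const (x ∷ xs) c = cong (c +_) (listSum-const xs c)

  listSum-0 : ∀ {A : Set} (xs : List A) {f : A → ℕ} → (∀ x → x ∈ xs → f x ≡ 0) → listSum xs f ≡ 0
  listSum-0 xs f≡0 = trans (listSum-cong xs f≡0) (trans (listSum-const xs 0) (*-zeroʳ (length xs)))

  listSum-+ : ∀ {A : Set} (xs : List A) (f g : A → ℕ) →
    listSum xs (λ x → f x + g x) ≡ listSum xs f + listSum xs g
  listSum-+ [] f g = refl
  listSum-+ (x ∷ xs) f g =
    trans (cong (f x + g x +_) (listSum-+ xs f g)) (swap (f x) (g x) (listSum xs f) (listSum xs g))
    where
    swap : ∀ a b c d → a + b + (c + d) ≡ a + c + (b + d)
    swap = solve-∀

  listSum-*ˡ : ∀ {A : Set} (xs : List A) c (f : A → ℕ) → listSum xs (λ x → c * f x) ≡ c * listSum xs f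
  listSum-*ˡ [] c f = sym (*-zeroʳ c)
  listSum-*ˡ (x ∷ xs) c f =
    trans (cong (c * f x +_) (listSum-*ˡ xs c f)) (sym (*-distribˡ-+ c (f x) (listSum xs f)))

  listSum-sumTo : ∀ {A : Set} (xs : List A) M (f : A → ℕ → ℕ) →
    listSum xs (λ x → sumTo M (f x)) ≡ sumTo M (λ d → listSum xs (λ x → f x d))
  listSum-sumTo xs zero f = listSum-0 xs (λ _ _ → refl)
  listSum-sumTo xs (suc M) f =
    trans (listSum-+ xs (λ x → sumTo M (f x)) (λ x → f x (suc M)))
          (cong (_+ listSum xs (λ x → f x (suc M))) (listSum-sumTo xs M f))

  listSum-swap : ∀ {A B : Set} (xs : List A) (ys : List B) (f : A → B → ℕ) →
    listSum xs (λ x → listSum ys (f x)) ≡ listSum ys (λ y → listSum xs (λ x → f x y))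
  listSum-swap [] ys f = sym (listSum-0 ys (λ _ _ → refl))
  listSum-swap (x ∷ xs) ys f =
    trans (cong (listSum ys (f x) +_) (listSum-swap xs ys f))
          (sym (listSum-+ ys (f x) (λ y → listSum xs (λ x → f x y))))

  listSum-𝕀 : ∀ {A : Set} {P : Pred A _} (P? : Decidable P) xs →
    listSum xs (λ x → 𝕀 (P? x)) ≡ length (filter P? xs)
  listSum-𝕀 P? [] = refl
  listSum-𝕀 P? (x ∷ xs) with P? x
  ... | yes _ = cong suc (listSum-𝕀 P? xs)
  ... | no _ = listSum-𝕀 P? xs

  listSum-𝕀≡ : ∀ {A : Set} (_≟_ : DecidableEquality A) xs x → Unique xs → x ∈ xs →
    listSum xs (λ y → 𝕀 (y ≟ x)) ≡ 1
  listSum-𝕀≡ _≟_ (y ∷ xs) .y (y∉xs ∷ _) (here refl) =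
    cong₂ _+_ (𝕀-yes refl (y ≟ y)) (listSum-0 xs (λ z z∈xs → 𝕀-no (λ { refl → All¬⇒¬Any y∉xs z∈xs }) (z ≟ y)))
  listSum-𝕀≡ _≟_ (y ∷ xs) x (y∉xs ∷ unique) (there x∈xs) =
    cong₂ _+_ (𝕀-no (λ { refl → All¬⇒¬Any y∉xs x∈xs }) (y ≟ x)) (listSum-𝕀≡ _≟_ xs x unique x∈xs)

  same-length : ∀ {A : Set} {xs ys : List A} → Unique xs → Unique ys →
    (∀ {x} → x ∈ xs → x ∈ ys) → (∀ {x} → x ∈ ys → x ∈ xs) → length xs ≡ length ys
  same-length uxs uys to from = ↭-length (∼bag⇒↭ (unique∧set⇒bag uxs uys (mk⇔ to from)))

  length-cartesianProductWith : ∀ {A B C : Set} (f : A → B → C) xs ys →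
    length (cartesianProductWith f xs ys) ≡ length xs * length ys
  length-cartesianProductWith f [] ys = refl
  length-cartesianProductWith f (x ∷ xs) ys =
    trans (length-++ (map (f x) ys)) (cong₂ _+_ (length-map (f x) ys) (length-cartesianProductWith f xs ys))

module Fields where

  open import Defs using (FiniteField)
  open import Algebra.Bundles using (RawRing)
  open import Algebra.Structures using (IsCommutativeRing)
  open import Algebra.Morphism.Structures using (IsRingMonomorphism)
  import Algebra.Morphism.RingMonomorphism as RingMonomorphism
  open import Data.Nat using (ℕ)
  open import Data.Fin using (Fin) renaming (_≟_ to _≟Fin_)
  open import Data.List using (List; length; allFin)
  open import Data.List.Properties using (length-tabulate)
  open import Data.List.Membership.Propositional using (_∈_)
  open import Data.List.Membership.Propositional.Properties using (∈-allFin)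
  open import Data.List.Relation.Unary.Unique.Propositional using (Unique)
  open import Data.List.Relation.Unary.Unique.Propositional.Properties using (allFin⁺)
  open import Data.Product using (Σ; _,_; proj₁; proj₂)
  open import Relation.Binary.Definitions using (DecidableEquality)
  open import Relation.Binary.PropositionalEquality as ≡ using (_≡_; _≢_)

  record DiscreteField : Set₁ where
    field
      K       : Set
      _≟_     : DecidableEquality K
      _⊕_ _⊛_ : K → K → K
      ⊝_      : K → K
      𝟘 𝟙     : K
      isCommutativeRing : IsCommutativeRing _≡_ _⊕_ _⊛_ ⊝_ 𝟘 𝟙
      𝟙≢𝟘     : 𝟙 ≢ 𝟘
      inverse : ∀ x → x ≢ 𝟘 → Σ K λ y → x ⊛ y ≡ 𝟙

  record Enumeration (𝔽 : DiscreteField) : Set where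
    field
      elements          : List (DiscreteField.K 𝔽)
      elements-complete : ∀ x → x ∈ elements
      elements-unique   : Unique elements

  -- A finite field with q elements (given up to a setoid equality and an enumeration)
  -- is a discrete field on Fin q: transport every operation along the enumeration.
  module FromFiniteField {q : ℕ} (F : FiniteField q) where
    open FiniteField F

    index : Carrier → Fin q
    index x = proj₁ (enum-surjective x)

    enum-index : ∀ x → enum (index x) ≈ x
    enum-index x = sym (proj₂ (enum-surjective x))

    _⊕_ _⊛_ : Fin q → Fin q → Fin q
    a ⊕ b = index (enum a + enum b)
    a ⊛ b = index (enum a * enum b)

    ⊝_ : Fin q → Fin q
    ⊝ a = index (- enum a)

    𝟘 𝟙 : Fin q
    𝟘 = index 0#
    𝟙 = index 1#

    finRawRing : RawRing _ _
    finRawRing = record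
      { _≈_ = _≡_ ; _+_ = _⊕_ ; _*_ = _⊛_ ; -_ = ⊝_ ; 0# = 𝟘 ; 1# = 𝟙 }

    enum-isRingMonomorphism : IsRingMonomorphism finRawRing rawRing enum
    enum-isRingMonomorphism = record
      { isRingHomomorphism = record
        { isSemiringHomomorphism = record
          { isNearSemiringHomomorphism = record
            { +-isMonoidHomomorphism = record
              { isMagmaHomomorphism = record
                { isRelHomomorphism = record { cong = λ a≡b → reflexive (≡.cong enum a≡b) }
                ; homo = λ a b → enum-index (enum a + enum b) }
              ; ε-homo = enum-index 0# }
            ; *-homo = λ a b → enum-index (enum a * enum b) }
          ; 1#-homo = enum-index 1# }
        ; -‿homo = λ a → enum-index (- enum a) }
      ; injective = enum-injective _ _ }

    discreteField : DiscreteField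
    discreteField = record
      { K = Fin q
      ; _≟_ = _≟Fin_
      ; _⊕_ = _⊕_ ; _⊛_ = _⊛_ ; ⊝_ = ⊝_ ; 𝟘 = 𝟘 ; 𝟙 = 𝟙
      ; isCommutativeRing = RingMonomorphism.isCommutativeRing enum-isRingMonomorphism isCommutativeRing
      ; 𝟙≢𝟘 = λ 𝟙≡𝟘 → 1≉0 (trans (sym (enum-index 1#)) (trans (reflexive (≡.cong enum 𝟙≡𝟘)) (enum-index 0#)))
      ; inverse = invert
      }
      where
      invert : ∀ x → x ≢ 𝟘 → Σ (Fin q) λ y → x ⊛ y ≡ 𝟙
      invert x x≢𝟘 with inverse (enum x) (λ x≈0 → x≢𝟘 (enum-injective _ _ (trans x≈0 (sym (enum-index 0#)))))
      ... | y , xy≈1 = index y , enum-injective _ _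
            (trans (enum-index _) (trans (*-cong refl (enum-index y)) (trans xy≈1 (sym (enum-index 1#)))))

    enumeration : Enumeration discreteField
    enumeration = record
      { elements = allFin q ; elements-complete = ∈-allFin ; elements-unique = allFin⁺ q }

    enumeration-length : length (Enumeration.elements enumeration) ≡ q
    enumeration-length = length-tabulate _

module Polynomials (𝔽 : Fields.DiscreteField) where

  open Fields using (DiscreteField)
  open DiscreteField 𝔽 using (K; _≟_; isCommutativeRing; 𝟙≢𝟘; inverse)
  open import Algebra.Structures using (IsCommutativeRing)
  open import Algebra.Bundles using (CommutativeRing; AbelianGroup)
  import Algebra.Properties.Group as GroupProperties
  import Algebra.Properties.Ring as RingProperties
  open import Tactic.RingSolver.Core.AlmostCommutativeRing using (AlmostCommutativeRing; fromCommutativeRing)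
  open import Tactic.RingSolver using (solve-∀)
  open import Data.Maybe using (nothing)
  open import Data.Nat using (ℕ; zero; suc; _≤_; _<_; z≤n; s≤s; _∸_) renaming (_+_ to _+ℕ_)
  open import Data.Nat.Properties
    using (≤-refl; ≤-trans; m≤m+n; m≤n+m; <-cmp; m+n∸m≡n; m≤n⇒m≤1+n; <⇒≤; ≤-pred; m≤n⇒m<n∨m≡n)
  open import Data.List using (List; []; _∷_; map; _++_)
  open import Data.Vec using (Vec; toList) renaming ([] to []v; _∷_ to _∷v_)
  open import Data.Product using (Σ; _×_; _,_; proj₁; proj₂)
  open import Data.Sum using (_⊎_; inj₁; inj₂)
  open import Data.Empty using (⊥-elim)
  open import Relation.Nullary using (¬_; Dec; yes; no)
  open import Relation.Binary.Structures using (IsEquivalence)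
  open import Relation.Binary.Definitions using (tri<; tri≈; tri>)
  open import Relation.Binary.PropositionalEquality

  K-commutativeRing : CommutativeRing _ _
  K-commutativeRing = record { isCommutativeRing = isCommutativeRing }

  K-ring : AlmostCommutativeRing _ _
  K-ring = fromCommutativeRing K-commutativeRing (λ _ → nothing)

  open AlmostCommutativeRing K-ring public using ()
    renaming (_+_ to _⊕_; _*_ to _⊛_; -_ to ⊝_; 0# to 𝟘; 1# to 𝟙)
  open IsCommutativeRing isCommutativeRing
    using (+-identityˡ; +-identityʳ; *-identityˡ; *-identityʳ; zeroʳ; zeroˡ; +-assoc; +-comm;
           *-assoc; *-comm; -‿inverseʳ; distribˡ)
  open GroupProperties (AbelianGroup.group (CommutativeRing.+-abelianGroup K-commutativeRing)) using (ε⁻¹≈ε)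
  open RingProperties (CommutativeRing.ring K-commutativeRing) using (-‿distribˡ-*)

  Poly : Set
  Poly = List K

  coeff : Poly → ℕ → K
  coeff [] n = 𝟘
  coeff (a ∷ f) zero = a
  coeff (a ∷ f) (suc n) = coeff f n

  -- Equality of polynomials: equal coefficients (trailing zeros are irrelevant).
  infix 4 _≋_
  record _≋_ (f g : Poly) : Set where
    constructor mk≋
    field at : ∀ n → coeff f n ≡ coeff g n
  open _≋_ public

  ≋-refl : ∀ {f} → f ≋ f
  ≋-refl = mk≋ λ n → refl

  ≋-sym : ∀ {f g} → f ≋ g → g ≋ f
  ≋-sym f≋g = mk≋ λ n → sym (at f≋g n)

  ≋-trans : ∀ {f g h} → f ≋ g → g ≋ h → f ≋ h
  ≋-trans f≋g g≋h = mk≋ λ n → trans (at f≋g n) (at g≋h n)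

  ≋-isEquivalence : IsEquivalence _≋_
  ≋-isEquivalence = record { refl = ≋-refl ; sym = ≋-sym ; trans = ≋-trans }

  ≡⇒≋ : ∀ {f g} → f ≡ g → f ≋ g
  ≡⇒≋ refl = ≋-refl

  ≋-∷ : ∀ {a b f g} → a ≡ b → f ≋ g → (a ∷ f) ≋ (b ∷ g)
  ≋-∷ {a} {b} {f} {g} a≡b f≋g = mk≋ coeffs
    where
    coeffs : ∀ n → coeff (a ∷ f) n ≡ coeff (b ∷ g) n
    coeffs zero = a≡b
    coeffs (suc n) = at f≋g n

  ≋-head : ∀ {a b f g} → (a ∷ f) ≋ (b ∷ g) → a ≡ b
  ≋-head e = at e 0

  ≋-tail : ∀ {a b f g} → (a ∷ f) ≋ (b ∷ g) → f ≋ g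
  ≋-tail e = mk≋ λ n → at e (suc n)

  addP : Poly → Poly → Poly
  addP [] g = g
  addP (a ∷ f) [] = a ∷ f
  addP (a ∷ f) (b ∷ g) = (a ⊕ b) ∷ addP f g

  scal : K → Poly → Poly
  scal c f = map (c ⊛_) f

  xP : Poly → Poly
  xP h = 𝟘 ∷ h

  mulP : Poly → Poly → Poly
  mulP [] g = []
  mulP (a ∷ f) g = addP (map (a ⊛_) g) (𝟘 ∷ mulP f g)

  negP : Poly → Poly
  negP f = map ⊝_ f

  oneP : Poly
  oneP = 𝟙 ∷ []

  constP : K → Poly
  constP a = a ∷ []

  XP : Poly
  XP = 𝟘 ∷ 𝟙 ∷ []

  coeff-add : ∀ f g n → coeff (addP f g) n ≡ coeff f n ⊕ coeff g n
  coeff-add [] g n = sym (+-identityˡ _)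
  coeff-add (a ∷ f) [] n = sym (+-identityʳ _)
  coeff-add (a ∷ f) (b ∷ g) zero = refl
  coeff-add (a ∷ f) (b ∷ g) (suc n) = coeff-add f g n

  coeff-scal : ∀ c f n → coeff (scal c f) n ≡ c ⊛ coeff f n
  coeff-scal c [] n = sym (zeroʳ c)
  coeff-scal c (a ∷ f) zero = refl
  coeff-scal c (a ∷ f) (suc n) = coeff-scal c f n

  coeff-neg : ∀ f n → coeff (negP f) n ≡ ⊝ coeff f n
  coeff-neg [] n = sym ε⁻¹≈ε
  coeff-neg (a ∷ f) zero = refl
  coeff-neg (a ∷ f) (suc n) = coeff-neg f n

  coeff-x-add : ∀ f g n → coeff (xP (addP f g)) n ≡ coeff (xP f) n ⊕ coeff (xP g) n
  coeff-x-add f g zero = sym (+-identityˡ 𝟘)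
  coeff-x-add f g (suc n) = coeff-add f g n

  coeff-mul-zero : ∀ a f g → coeff (mulP (a ∷ f) g) 0 ≡ a ⊛ coeff g 0
  coeff-mul-zero a f g =
    trans (coeff-add (scal a g) (xP (mulP f g)) 0) (trans (cong (_⊕ 𝟘) (coeff-scal a g 0)) (+-identityʳ _))

  coeff-mul-suc : ∀ a f g n → coeff (mulP (a ∷ f) g) (suc n) ≡ a ⊛ coeff g (suc n) ⊕ coeff (mulP f g) n
  coeff-mul-suc a f g n =
    trans (coeff-add (scal a g) (xP (mulP f g)) (suc n)) (cong (_⊕ coeff (mulP f g) n) (coeff-scal a g (suc n)))

  add-cong : ∀ {f f′ g g′} → f ≋ f′ → g ≋ g′ → addP f g ≋ addP f′ g′
  add-cong {f} {f′} {g} {g′} f≋ g≋ =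
    mk≋ λ n → trans (coeff-add f g n) (trans (cong₂ _⊕_ (at f≋ n) (at g≋ n)) (sym (coeff-add f′ g′ n)))

  scal-cong : ∀ {c f f′} → f ≋ f′ → scal c f ≋ scal c f′
  scal-cong {c} {f} {f′} f≋ =
    mk≋ λ n → trans (coeff-scal c f n) (trans (cong (c ⊛_) (at f≋ n)) (sym (coeff-scal c f′ n)))

  neg-cong : ∀ {f f′} → f ≋ f′ → negP f ≋ negP f′
  neg-cong {f} {f′} f≋ =
    mk≋ λ n → trans (coeff-neg f n) (trans (cong ⊝_ (at f≋ n)) (sym (coeff-neg f′ n)))

  x-cong : ∀ {f g} → f ≋ g → xP f ≋ xP g
  x-cong = ≋-∷ refl

  mul-congʳ : ∀ f {g g′} → g ≋ g′ → mulP f g ≋ mulP f g′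
  mul-congʳ [] g≋ = ≋-refl
  mul-congʳ (a ∷ f) g≋ = add-cong (scal-cong g≋) (x-cong (mul-congʳ f g≋))

  scal-𝟘 : ∀ g → scal 𝟘 g ≋ []
  scal-𝟘 g = mk≋ λ n → trans (coeff-scal 𝟘 g n) (zeroˡ _)

  x[]≋[] : xP [] ≋ []
  x[]≋[] = mk≋ λ { zero → refl ; (suc n) → refl }

  mul-zeroˡ : ∀ {f} g → f ≋ [] → mulP f g ≋ []
  mul-zeroˡ {[]} g f≋0 = ≋-refl
  mul-zeroˡ {a ∷ f} g f≋0 = ≋-trans
    (add-cong {scal a g} {[]} {xP (mulP f g)} {xP []}
      (mk≋ λ k → trans (coeff-scal a g k) (trans (cong (_⊛ coeff g k) (at f≋0 0)) (zeroˡ _)))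
      (x-cong (mul-zeroˡ {f} g (mk≋ λ k → at f≋0 (suc k)))))
    x[]≋[]

  mul-congˡ : ∀ {f f′} g → f ≋ f′ → mulP f g ≋ mulP f′ g
  mul-congˡ {[]} {[]} g f≋ = ≋-refl
  mul-congˡ {[]} {b ∷ f′} g f≋ = ≋-sym (mul-zeroˡ g (≋-sym f≋))
  mul-congˡ {a ∷ f} {[]} g f≋ = mul-zeroˡ g f≋
  mul-congˡ {a ∷ f} {b ∷ f′} g f≋ rewrite ≋-head f≋ = add-cong ≋-refl (x-cong (mul-congˡ g (≋-tail f≋)))

  mul-cong : ∀ {f f′ g g′} → f ≋ f′ → g ≋ g′ → mulP f g ≋ mulP f′ g′
  mul-cong {f} {f′} {g} f≋ g≋ = ≋-trans (mul-congˡ g f≋) (mul-congʳ f′ g≋)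

  add-comm : ∀ f g → addP f g ≋ addP g f
  add-comm f g = mk≋ λ n → trans (coeff-add f g n) (trans (+-comm _ _) (sym (coeff-add g f n)))

  add-assoc : ∀ f g h → addP (addP f g) h ≋ addP f (addP g h)
  add-assoc f g h = mk≋ λ n → begin
    coeff (addP (addP f g) h) n        ≡⟨ trans (coeff-add (addP f g) h n) (cong (_⊕ coeff h n) (coeff-add f g n)) ⟩
    coeff f n ⊕ coeff g n ⊕ coeff h n  ≡⟨ +-assoc _ _ _ ⟩
    coeff f n ⊕ (coeff g n ⊕ coeff h n) ≡⟨ sym (trans (coeff-add f (addP g h) n) (cong (coeff f n ⊕_) (coeff-add g h n))) ⟩
    coeff (addP f (addP g h)) n        ∎
    where open ≡-Reasoning

  add-idˡ : ∀ f → addP [] f ≋ f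
  add-idˡ f = ≋-refl

  add-idʳ : ∀ f → addP f [] ≋ f
  add-idʳ f = mk≋ λ n → trans (coeff-add f [] n) (+-identityʳ _)

  add-invʳ : ∀ f → addP f (negP f) ≋ []
  add-invʳ f = mk≋ λ n → trans (coeff-add f (negP f) n) (trans (cong (coeff f n ⊕_) (coeff-neg f n)) (-‿inverseʳ _))

  add-invˡ : ∀ f → addP (negP f) f ≋ []
  add-invˡ f = ≋-trans (add-comm (negP f) f) (add-invʳ f)

  scal-𝟙 : ∀ g → scal 𝟙 g ≋ g
  scal-𝟙 g = mk≋ λ n → trans (coeff-scal 𝟙 g n) (*-identityˡ _)

  scal-add : ∀ a f g → scal a (addP f g) ≋ addP (scal a f) (scal a g)
  scal-add a f g = mk≋ λ n →
    trans (coeff-scal a (addP f g) n) (trans (cong (a ⊛_) (coeff-add f g n)) (trans (distribˡ a _ _)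
      (sym (trans (coeff-add (scal a f) (scal a g) n) (cong₂ _⊕_ (coeff-scal a f n) (coeff-scal a g n))))))

  scal-x : ∀ a f → scal a (xP f) ≋ xP (scal a f)
  scal-x a f = ≋-∷ (zeroʳ a) ≋-refl

  scal-scal : ∀ a b h → scal (a ⊛ b) h ≋ scal a (scal b h)
  scal-scal a b h = mk≋ λ n →
    trans (coeff-scal (a ⊛ b) h n) (trans (*-assoc a b _)
      (sym (trans (coeff-scal a (scal b h) n) (cong (a ⊛_) (coeff-scal b h n)))))

  mul-idˡ : ∀ g → mulP oneP g ≋ g
  mul-idˡ g = ≋-trans (add-cong (scal-𝟙 g) x[]≋[]) (add-idʳ g)

  mul-scal : ∀ a g h → mulP (scal a g) h ≋ scal a (mulP g h)
  mul-scal a [] h = ≋-refl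
  mul-scal a (b ∷ g) h = ≋-trans (add-cong (scal-scal a b h) (x-cong (mul-scal a g h)))
    (≋-trans (add-cong ≋-refl (≋-sym (scal-x a (mulP g h)))) (≋-sym (scal-add a (scal b h) (xP (mulP g h)))))

  mul-x : ∀ f h → mulP (xP f) h ≋ xP (mulP f h)
  mul-x f h = add-cong (scal-𝟘 h) ≋-refl

  distribʳP : ∀ f g h → mulP (addP f g) h ≋ addP (mulP f h) (mulP g h)
  distribʳP [] g h = ≋-refl
  distribʳP (a ∷ f) [] h = ≋-sym (add-idʳ _)
  distribʳP (a ∷ f) (b ∷ g) h = ≋-trans (add-cong ≋-refl (x-cong (distribʳP f g h))) (mk≋ λ n → begin
    coeff (addP (scal (a ⊕ b) h) (xP (addP (mulP f h) (mulP g h)))) n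
      ≡⟨ trans (coeff-add (scal (a ⊕ b) h) _ n) (cong₂ _⊕_ (coeff-scal (a ⊕ b) h n) (coeff-x-add (mulP f h) (mulP g h) n)) ⟩
    (a ⊕ b) ⊛ coeff h n ⊕ (coeff (xP (mulP f h)) n ⊕ coeff (xP (mulP g h)) n)
      ≡⟨ regroup a b (coeff h n) _ _ ⟩
    (a ⊛ coeff h n ⊕ coeff (xP (mulP f h)) n) ⊕ (b ⊛ coeff h n ⊕ coeff (xP (mulP g h)) n)
      ≡⟨ sym (trans (coeff-add (mulP (a ∷ f) h) (mulP (b ∷ g) h) n) (cong₂ _⊕_ (product-coeff a f n) (product-coeff b g n))) ⟩
    coeff (addP (mulP (a ∷ f) h) (mulP (b ∷ g) h)) n ∎)
    where
    open ≡-Reasoning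
    regroup : ∀ a b H P Q → (a ⊕ b) ⊛ H ⊕ (P ⊕ Q) ≡ (a ⊛ H ⊕ P) ⊕ (b ⊛ H ⊕ Q)
    regroup = solve-∀ K-ring
    product-coeff : ∀ c k n → coeff (mulP (c ∷ k) h) n ≡ c ⊛ coeff h n ⊕ coeff (xP (mulP k h)) n
    product-coeff c k n = trans (coeff-add (scal c h) (xP (mulP k h)) n) (cong (_⊕ coeff (xP (mulP k h)) n) (coeff-scal c h n))

  mul-consʳ : ∀ g a f → mulP g (a ∷ f) ≋ addP (scal a g) (xP (mulP g f))
  mul-consʳ [] a f = ≋-sym x[]≋[]
  mul-consʳ (b ∷ g) a f = ≋-trans (add-cong {scal b (a ∷ f)} ≋-refl (x-cong (mul-consʳ g a f))) (mk≋ coeffs)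
    where
    W = mulP g f
    swap : ∀ b F a G X → b ⊛ F ⊕ (a ⊛ G ⊕ X) ≡ a ⊛ G ⊕ (b ⊛ F ⊕ X)
    swap = solve-∀ K-ring
    coeffs : ∀ n → coeff (addP (scal b (a ∷ f)) (xP (addP (scal a g) (xP W)))) n
                 ≡ coeff (addP (scal a (b ∷ g)) (xP (addP (scal b f) (xP W)))) n
    coeffs zero = cong (_⊕ 𝟘) (*-comm b a)
    coeffs (suc n) =
      trans (coeff-add (scal b f) (addP (scal a g) (xP W)) n)
      (trans (cong₂ _⊕_ (coeff-scal b f n) (trans (coeff-add (scal a g) (xP W) n) (cong (_⊕ coeff (xP W) n) (coeff-scal a g n))))
      (trans (swap b (coeff f n) a (coeff g n) (coeff (xP W) n))
      (sym (trans (coeff-add (scal a g) (addP (scal b f) (xP W)) n)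
      (cong₂ _⊕_ (coeff-scal a g n) (trans (coeff-add (scal b f) (xP W) n) (cong (_⊕ coeff (xP W) n) (coeff-scal b f n))))))))

  mul-zeroʳ : ∀ g → mulP g [] ≋ []
  mul-zeroʳ [] = ≋-refl
  mul-zeroʳ (a ∷ g) = ≋-trans (x-cong (mul-zeroʳ g)) x[]≋[]

  mul-comm : ∀ f g → mulP f g ≋ mulP g f
  mul-comm [] g = ≋-sym (mul-zeroʳ g)
  mul-comm (a ∷ f) g = ≋-trans (add-cong ≋-refl (x-cong (mul-comm f g))) (≋-sym (mul-consʳ g a f))

  mul-assoc : ∀ f g h → mulP (mulP f g) h ≋ mulP f (mulP g h)
  mul-assoc [] g h = ≋-refl
  mul-assoc (a ∷ f) g h = ≋-trans (distribʳP (scal a g) (xP (mulP f g)) h)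
    (add-cong (mul-scal a g h) (≋-trans (mul-x (mulP f g) h) (x-cong (mul-assoc f g h))))

  mul-idʳ : ∀ g → mulP g oneP ≋ g
  mul-idʳ g = ≋-trans (mul-comm g oneP) (mul-idˡ g)

  distribˡP : ∀ f g h → mulP f (addP g h) ≋ addP (mulP f g) (mulP f h)
  distribˡP f g h =
    ≋-trans (mul-comm f (addP g h)) (≋-trans (distribʳP g h f) (add-cong (mul-comm g f) (mul-comm h f)))

  Poly-isCommutativeRing : IsCommutativeRing _≋_ addP mulP negP [] oneP
  Poly-isCommutativeRing = record
    { isRing = record
      { +-isAbelianGroup = record
        { isGroup = record
          { isMonoid = record
            { isSemigroup = record
              { isMagma = record { isEquivalence = ≋-isEquivalence ; ∙-cong = add-cong }
              ; assoc = add-assoc }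
            ; identity = add-idˡ , add-idʳ }
          ; inverse = add-invˡ , add-invʳ
          ; ⁻¹-cong = neg-cong }
        ; comm = add-comm }
      ; *-cong = mul-cong
      ; *-assoc = mul-assoc
      ; *-identity = mul-idˡ , mul-idʳ
      ; distrib = distribˡP , (λ x y z → distribʳP y z x) }
    ; *-comm = mul-comm }

  Poly-commutativeRing : CommutativeRing _ _
  Poly-commutativeRing = record { isCommutativeRing = Poly-isCommutativeRing }

  Poly-ring : AlmostCommutativeRing _ _
  Poly-ring = fromCommutativeRing Poly-commutativeRing (λ _ → nothing)

  open AlmostCommutativeRing Poly-ring using () renaming (_+_ to _+P_; _*_ to _*P_)
  module PolyGroup = GroupProperties (AbelianGroup.group (CommutativeRing.+-abelianGroup Poly-commutativeRing))
  module PolyRing = RingProperties (CommutativeRing.ring Poly-commutativeRing)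

  xP≋X* : ∀ h → xP h ≋ mulP XP h
  xP≋X* h = ≋-sym (add-cong (scal-𝟘 h) (x-cong (mul-idˡ h)))

  scal≋const* : ∀ a h → scal a h ≋ mulP (constP a) h
  scal≋const* a h = ≋-sym (≋-trans (add-cong ≋-refl x[]≋[]) (add-idʳ _))

  ∷≋const+X* : ∀ a h → (a ∷ h) ≋ addP (constP a) (mulP XP h)
  ∷≋const+X* a h = ≋-trans (≋-∷ (sym (+-identityʳ a)) ≋-refl) (add-cong {constP a} ≋-refl (xP≋X* h))

  scal-⊝ : ∀ a h → scal (⊝ a) h ≋ negP (scal a h)
  scal-⊝ a h = mk≋ λ n → trans (coeff-scal (⊝ a) h n)
    (trans (sym (-‿distribˡ-* a (coeff h n))) (sym (trans (coeff-neg (scal a h) n) (cong ⊝_ (coeff-scal a h n)))))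

  add-≋[]ʳ : ∀ {f g} → g ≋ [] → addP f g ≋ f
  add-≋[]ʳ {f} g≋0 = ≋-trans (add-cong (≋-refl {f}) g≋0) (add-idʳ f)

  neg-mulˡ : ∀ f g → mulP (negP f) g ≋ negP (mulP f g)
  neg-mulˡ f g = ≋-sym (PolyRing.-‿distribˡ-* f g)

  remainder≋ : ∀ {f g r} → f ≋ addP g r → r ≋ addP f (negP g)
  remainder≋ {f} {g} {r} f≋ = ≋-sym (≋-trans (add-cong f≋ ≋-refl) (cancel g r (negP g)))
    where
    regroup : ∀ a b n → (a +P b) +P n ≋ b +P (a +P n)
    regroup = solve-∀ Poly-ring
    cancel : ∀ a b n → addP (addP a b) (negP a) ≋ b
    cancel a b _ = ≋-trans (regroup a b (negP a)) (add-≋[]ʳ (add-invʳ a))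

  remainder-mul : ∀ {f Q g R} h → f ≋ addP (mulP Q g) R →
    mulP R h ≋ addP (mulP f h) (negP (mulP Q (mulP g h)))
  remainder-mul {f} {Q} {g} {R} h f≋ = ≋-trans (mul-congˡ h (remainder≋ f≋))
    (≋-trans (distribʳP f (negP (mulP Q g)) h)
      (add-cong ≋-refl (≋-trans (neg-mulˡ (mulP Q g) h) (neg-cong (mul-assoc Q g h)))))

  -- Degrees.  Below f m: all coefficients from index m on vanish (deg f < m).
  -- Deg f m c: deg f ≤ m with m-th coefficient c (so for c ≠ 0, deg f = m).
  Below : Poly → ℕ → Set
  Below f m = ∀ k → m ≤ k → coeff f k ≡ 𝟘

  Deg : Poly → ℕ → K → Set
  Deg f m c = Below f (suc m) × coeff f m ≡ c

  Below-cong : ∀ {f g} m → f ≋ g → Below f m → Below g m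
  Below-cong m f≋g below k m≤k = trans (sym (at f≋g k)) (below k m≤k)

  Deg-cong : ∀ {f g m c} → f ≋ g → Deg f m c → Deg g m c
  Deg-cong {m = m} f≋g (below , top) = Below-cong (suc m) f≋g below , trans (sym (at f≋g m)) top

  Below-zero : ∀ {f} → Below f 0 → f ≋ []
  Below-zero below = mk≋ λ k → below k z≤n

  ≋[]⇒Below : ∀ {f} m → f ≋ [] → Below f m
  ≋[]⇒Below m f≋0 k _ = at f≋0 k

  Below-mono : ∀ {f m n} → m ≤ n → Below f m → Below f n
  Below-mono m≤n below k n≤k = below k (≤-trans m≤n n≤k)

  monicP : ∀ {n} → Vec K n → Poly
  monicP v = toList v ++ (𝟙 ∷ [])

  Deg-monic : ∀ {n} (v : Vec K n) → Deg (monicP v) n 𝟙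
  Deg-monic []v = (λ { (suc k) _ → refl }) , refl
  Deg-monic (a ∷v v) with Deg-monic v
  ... | below , top = (λ { (suc k) (s≤s n≤k) → below k n≤k }) , top

  Deg-one : Deg oneP 0 𝟙
  Deg-one = (λ { (suc k) _ → refl }) , refl

  Deg-tail : ∀ {a f m c} → Deg (a ∷ f) (suc m) c → Deg f m c
  Deg-tail (below , top) = (λ k m≤k → below (suc k) (s≤s m≤k)) , top

  Deg-mul : ∀ A B i j α β → Deg A i α → Deg B j β → Deg (mulP A B) (i +ℕ j) (α ⊛ β)
  Deg-mul [] B i j α β (_ , top) _ = (λ k _ → refl) , trans (sym (zeroˡ β)) (cong (_⊛ β) top)
  Deg-mul (a ∷ A) B zero j α β (below , top) (belowB , topB) =
    Deg-cong (≋-sym product≋) (below-aB , trans (coeff-scal a B j) (cong₂ _⊛_ top topB))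
    where
    A≋0 : A ≋ []
    A≋0 = mk≋ λ k → below (suc k) (s≤s z≤n)
    product≋ : mulP (a ∷ A) B ≋ scal a B
    product≋ = ≋-trans (add-cong ≋-refl (≋-trans (x-cong (mul-zeroˡ B A≋0)) x[]≋[])) (add-idʳ _)
    below-aB : Below (scal a B) (suc j)
    below-aB k j<k = trans (coeff-scal a B k) (trans (cong (a ⊛_) (belowB k j<k)) (zeroʳ a))
  Deg-mul (a ∷ A) B (suc i) j α β degA degB@(belowB , _) with Deg-mul A B i j α β (Deg-tail degA) degB
  ... | below , top = below′ , top′
    where
    vanish : ∀ k → i +ℕ j ≤ k → a ⊛ coeff B (suc k) ⊕ coeff (mulP A B) k ≡ coeff (mulP A B) k
    vanish k i+j≤k = trans (cong (_⊕ coeff (mulP A B) k)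
      (trans (cong (a ⊛_) (belowB (suc k) (s≤s (≤-trans (m≤n+m j i) i+j≤k)))) (zeroʳ a))) (+-identityˡ _)
    below′ : Below (mulP (a ∷ A) B) (suc (suc (i +ℕ j)))
    below′ (suc k) (s≤s i+j<k) =
      trans (coeff-mul-suc a A B k) (trans (vanish k (<⇒≤ i+j<k)) (below k i+j<k))
    top′ : coeff (mulP (a ∷ A) B) (suc i +ℕ j) ≡ α ⊛ β
    top′ = trans (coeff-mul-suc a A B (i +ℕ j)) (trans (vanish (i +ℕ j) ≤-refl) top)

  Deg-mul-monic : ∀ A B {i j} → Deg A i 𝟙 → Deg B j 𝟙 → Deg (mulP A B) (i +ℕ j) 𝟙
  Deg-mul-monic A B {i} {j} deg-A deg-B =
    subst (Deg (mulP A B) (i +ℕ j)) (*-identityˡ 𝟙) (Deg-mul A B i j 𝟙 𝟙 deg-A deg-B)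

  ≋[]? : ∀ f → Dec (f ≋ [])
  ≋[]? [] = yes ≋-refl
  ≋[]? (a ∷ f) with a ≟ 𝟘 | ≋[]? f
  ... | yes a≡0 | yes f≋0 = yes (≋-trans (≋-∷ a≡0 f≋0) x[]≋[])
  ... | no a≢0 | _ = no λ e → a≢0 (at e 0)
  ... | yes _ | no f≉0 = no λ e → f≉0 (mk≋ λ k → at e (suc k))

  leading : ∀ f → ¬ (f ≋ []) → Σ ℕ λ k → Σ K λ c → ¬ (c ≡ 𝟘) × Deg f k c
  leading [] f≉0 = ⊥-elim (f≉0 ≋-refl)
  leading (a ∷ f) af≉0 with ≋[]? f
  ... | yes f≋0 = 0 , a , (λ a≡0 → af≉0 (≋-trans (≋-∷ a≡0 f≋0) x[]≋[])) , (λ { (suc k) _ → at f≋0 k }) , refl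
  ... | no f≉0 with leading f f≉0
  ...   | k , c , c≢0 , (below , top) = suc k , c , c≢0 , (λ { (suc k′) (s≤s k<k′) → below k′ k<k′ }) , top

  Deg<Below : ∀ {f k c m} → ¬ (c ≡ 𝟘) → Deg f k c → Below f m → k < m
  Deg<Below {k = k} {m = m} c≢0 (_ , top) below with <-cmp k m
  ... | tri< k<m _ _ = k<m
  ... | tri≈ _ refl _ = ⊥-elim (c≢0 (trans (sym top) (below k ≤-refl)))
  ... | tri> _ _ m<k = ⊥-elim (c≢0 (trans (sym top) (below k (<⇒≤ m<k))))

  Deg-unique : ∀ {f a b α β} → ¬ (α ≡ 𝟘) → ¬ (β ≡ 𝟘) → Deg f a α → Deg f b β → (a ≡ b) × (α ≡ β)
  Deg-unique {a = a} {b} α≢0 β≢0 (belowa , topa) (belowb , topb) with <-cmp a b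
  ... | tri< a<b _ _ = ⊥-elim (β≢0 (trans (sym topb) (belowa b a<b)))
  ... | tri≈ _ refl _ = refl , trans (sym topa) topb
  ... | tri> _ _ b<a = ⊥-elim (α≢0 (trans (sym topa) (belowb a b<a)))

  tailP : Poly → Poly
  tailP [] = []
  tailP (a ∷ f) = f

  ≋head∷tail : ∀ f → f ≋ (coeff f 0 ∷ tailP f)
  ≋head∷tail [] = ≋-sym x[]≋[]
  ≋head∷tail (a ∷ f) = ≋-refl

  coeff-tail : ∀ f k → coeff (tailP f) k ≡ coeff f (suc k)
  coeff-tail [] k = refl
  coeff-tail (a ∷ f) k = refl

  lowerCoeffs : ∀ k → Poly → Vec K k
  lowerCoeffs zero f = []v
  lowerCoeffs (suc k) f = coeff f 0 ∷v lowerCoeffs k (tailP f)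

  ≋monic-lowerCoeffs : ∀ k f → Deg f k 𝟙 → f ≋ monicP (lowerCoeffs k f)
  ≋monic-lowerCoeffs zero f (below , top) =
    ≋-trans (≋head∷tail f) (≋-∷ top (mk≋ λ n → trans (coeff-tail f n) (below (suc n) (s≤s z≤n))))
  ≋monic-lowerCoeffs (suc k) f (below , top) = ≋-trans (≋head∷tail f) (≋-∷ refl (≋monic-lowerCoeffs k (tailP f)
    ((λ n k<n → trans (coeff-tail f n) (below (suc n) (s≤s k<n))) , trans (coeff-tail f k) top)))

  -- Division with remainder by a monic g of degree m:  f = Q·g + R  with deg R < m.
  -- Induction on f = a ∷ f′: from f′ = Q′·g + R′, cancel the x^m term of a + x·R′.
  divide : ∀ m g → Deg g m 𝟙 → ∀ f → Σ Poly λ Q → Σ Poly λ R → (f ≋ addP (mulP Q g) R) × Below R m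
  divide zero g deg-g f =
    f , [] , ≋-sym (≋-trans (add-idʳ _) (≋-trans (mul-congʳ f (≋monic-lowerCoeffs zero g deg-g)) (mul-idʳ f))) ,
    λ k _ → refl
  divide (suc m) g deg-g [] = [] , [] , ≋-refl , λ k _ → refl
  divide (suc m) g deg-g (a ∷ f) with divide (suc m) g deg-g f
  ... | Q′ , R′ , f≋ , below′ = (c ∷ Q′) , R , a∷f≋ , below
    where
    c = coeff R′ m
    R = addP (a ∷ R′) (scal (⊝ c) g)
    identity : ∀ C Q A R N → (C +P XP *P Q) +P ((A +P XP *P R) +P N) ≋ (A +P XP *P (Q +P R)) +P (C +P N)
    identity = solve-∀ Poly-ring
    a∷f≋ : (a ∷ f) ≋ addP (mulP (c ∷ Q′) g) R
    a∷f≋ = ≋-sym (≋-trans (add-cong (add-cong (scal≋const* c g) (xP≋X* (mulP Q′ g))) (add-cong (∷≋const+X* a R′) (scal-⊝ c g)))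
            (≋-trans (identity (mulP (constP c) g) (mulP Q′ g) (constP a) R′ (negP (scal c g)))
            (≋-trans (add-≋[]ʳ (≋-trans (add-cong (≋-sym (scal≋const* c g)) ≋-refl) (add-invʳ (scal c g))))
            (≋-sym (≋-trans (≋-∷ refl f≋) (∷≋const+X* a (addP (mulP Q′ g) R′)))))))
    below : Below R (suc m)
    below (suc k) (s≤s m≤k) with m≤n⇒m<n∨m≡n m≤k
    ... | inj₂ refl = trans (coeff-add (a ∷ R′) (scal (⊝ c) g) (suc k))
           (trans (cong (c ⊕_) (trans (coeff-scal (⊝ c) g (suc k)) (trans (cong (⊝ c ⊛_) (proj₂ deg-g)) (*-identityʳ _))))
                  (-‿inverseʳ c))
    ... | inj₁ m<k = trans (coeff-add (a ∷ R′) (scal (⊝ c) g) (suc k))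
           (trans (cong₂ _⊕_ (below′ k m<k) (trans (coeff-scal (⊝ c) g (suc k))
                  (trans (cong (⊝ c ⊛_) (proj₁ deg-g (suc k) (s≤s m<k))) (zeroʳ _)))) (+-identityˡ 𝟘))

  coeff-top : ∀ m g a Q → Deg g m 𝟙 → Q ≋ [] → coeff (mulP (a ∷ Q) g) m ≡ a
  coeff-top zero g a Q deg-g Q≋0 = trans (coeff-mul-zero a Q g) (trans (cong (a ⊛_) (proj₂ deg-g)) (*-identityʳ a))
  coeff-top (suc m) g a Q deg-g Q≋0 =
    trans (coeff-mul-suc a Q g m) (trans (cong₂ _⊕_ (cong (a ⊛_) (proj₂ deg-g)) (at (mul-zeroˡ g Q≋0) m))
      (trans (+-identityʳ _) (*-identityʳ a)))

  mul-monic-Below⇒≋[] : ∀ m g → Deg g m 𝟙 → ∀ Q → Below (mulP Q g) m → Q ≋ []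
  mul-monic-Below⇒≋[] m g deg-g [] _ = ≋-refl
  mul-monic-Below⇒≋[] m g deg-g (a ∷ Q) below = ≋-trans (≋-∷ a≡0 Q≋0) x[]≋[]
    where
    below-Qg : Below (mulP Q g) m
    below-Qg k m≤k = trans
      (sym (trans (cong (_⊕ coeff (mulP Q g) k) (trans (cong (a ⊛_) (proj₁ deg-g (suc k) (s≤s m≤k))) (zeroʳ a)))
                  (+-identityˡ _)))
      (trans (sym (coeff-mul-suc a Q g k)) (below (suc k) (m≤n⇒m≤1+n m≤k)))
    Q≋0 : Q ≋ []
    Q≋0 = mul-monic-Below⇒≋[] m g deg-g Q below-Qg
    a≡0 : a ≡ 𝟘
    a≡0 = trans (sym (coeff-top m g a Q deg-g Q≋0)) (below m ≤-refl)

  monic-cancelˡ : ∀ m g → Deg g m 𝟙 → ∀ A B → mulP g A ≋ mulP g B → A ≋ B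
  monic-cancelˡ m g deg-g A B gA≋gB = PolyGroup.x∙y⁻¹≈ε⇒x≈y A B D≋0
    where
    D = addP A (negP B)
    Dg≋0 : mulP D g ≋ []
    Dg≋0 = ≋-trans (distribʳP A (negP B) g)
      (≋-trans (add-cong (mul-comm A g) (≋-trans (neg-mulˡ B g) (neg-cong (≋-trans (mul-comm B g) (≋-sym gA≋gB)))))
               (add-invʳ (mulP g A)))
    D≋0 : D ≋ []
    D≋0 = mul-monic-Below⇒≋[] m g deg-g D (≋[]⇒Below m Dg≋0)

  record Dvd (g f : Poly) : Set where
    constructor _,d_
    field
      quotient : Poly
      factorisation : f ≋ mulP g quotient
  open Dvd public

  dvd? : ∀ m g → Deg g m 𝟙 → ∀ f → Dec (Dvd g f)
  dvd? m g deg-g f with divide m g deg-g f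
  ... | Q , R , f≋ , below with ≋[]? R
  ...   | yes R≋0 = yes (Q ,d ≋-trans f≋ (≋-trans (add-≋[]ʳ R≋0) (mul-comm Q g)))
  ...   | no R≉0 = no λ { (h ,d f≋gh) → R≉0 (remainder≋0 h f≋gh) }
    where
    remainder≋0 : ∀ h → f ≋ mulP g h → R ≋ []
    remainder≋0 h f≋gh = ≋-trans (≋-sym DgR) (mul-zeroˡ g D≋0)
      where
      D = addP h (negP Q)
      DgR : mulP D g ≋ R
      DgR = ≋-trans (distribʳP h (negP Q) g)
        (≋-trans (add-cong (≋-trans (mul-comm h g) (≋-sym f≋gh)) (neg-mulˡ Q g)) (≋-sym (remainder≋ f≋)))
      D≋0 : D ≋ []
      D≋0 = mul-monic-Below⇒≋[] m g deg-g D (Below-cong m (≋-sym DgR) below)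

  quotient-degree : ∀ m n g f h → Deg g m 𝟙 → Deg f n 𝟙 → f ≋ mulP g h → (m ≤ n) × Deg h (n ∸ m) 𝟙
  quotient-degree m n g f h deg-g deg-f f≋gh with ≋[]? h
  ... | yes h≋0 = ⊥-elim (𝟙≢𝟘 (trans (sym (proj₂ deg-f)) (trans (at f≋gh n) (at (≋-trans (mul-congʳ g h≋0) (mul-zeroʳ g)) n))))
  ... | no h≉0 with leading h h≉0
  ...   | k , c , c≢0 , deg-h with Deg-unique {f} 𝟙≢𝟘 (λ 𝟙c≡0 → c≢0 (trans (sym (*-identityˡ c)) 𝟙c≡0)) deg-f
                                     (Deg-cong (≋-sym f≋gh) (Deg-mul g h m k 𝟙 c deg-g deg-h))
  ...     | refl , 1≡1c = m≤m+n m k , subst (λ z → Deg h z 𝟙) (sym (m+n∸m≡n m k))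
                                    (proj₁ deg-h , trans (proj₂ deg-h) (trans (sym (*-identityˡ c)) (sym 1≡1c)))

  dvd-resp : ∀ {P u v} → u ≋ v → Dvd P u → Dvd P v
  dvd-resp u≋v (h ,d u≋) = h ,d ≋-trans (≋-sym u≋v) u≋

  dvd-respˡ : ∀ {P Q u} → P ≋ Q → Dvd P u → Dvd Q u
  dvd-respˡ P≋Q (h ,d u≋) = h ,d ≋-trans u≋ (mul-congˡ h P≋Q)

  dvd-refl : ∀ {P} → Dvd P P
  dvd-refl {P} = oneP ,d ≋-sym (mul-idʳ P)

  dvd-one : ∀ F → Dvd oneP F
  dvd-one F = F ,d ≋-sym (mul-idˡ F)

  dvd-mulʳ : ∀ {P u} w → Dvd P u → Dvd P (mulP u w)
  dvd-mulʳ {P} w (h ,d u≋) = mulP h w ,d ≋-trans (mul-congˡ w u≋) (mul-assoc P h w)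

  dvd-mulˡ : ∀ {P u} w → Dvd P u → Dvd P (mulP w u)
  dvd-mulˡ {u = u} w P∣u = dvd-resp (mul-comm u w) (dvd-mulʳ w P∣u)

  dvd-add : ∀ {P u v} → Dvd P u → Dvd P v → Dvd P (addP u v)
  dvd-add {P} (h ,d u≋) (h′ ,d v≋) = addP h h′ ,d ≋-trans (add-cong u≋ v≋) (≋-sym (distribˡP P h h′))

  dvd-neg : ∀ {P u} → Dvd P u → Dvd P (negP u)
  dvd-neg {P} (h ,d u≋) = negP h ,d ≋-trans (neg-cong u≋) (PolyRing.-‿distribʳ-* P h)

  dvd-scal : ∀ {P u} c → Dvd P u → Dvd P (scal c u)
  dvd-scal {u = u} c P∣u = dvd-resp (≋-sym (scal≋const* c u)) (dvd-mulˡ (constP c) P∣u)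

  dvd-trans : ∀ {P Q u} → Dvd P Q → Dvd Q u → Dvd P u
  dvd-trans {P} (h ,d Q≋) (h′ ,d u≋) = mulP h h′ ,d ≋-trans u≋ (≋-trans (mul-congˡ h′ Q≋) (mul-assoc P h h′))

  dvd-mul-both : ∀ {A B} p → Dvd A B → Dvd (mulP p A) (mulP p B)
  dvd-mul-both {A} p (h ,d B≋) = h ,d ≋-trans (mul-congʳ p B≋) (≋-sym (mul-assoc p A h))

  dvd-cancel : ∀ {p d A B} → Deg p d 𝟙 → Dvd (mulP p A) (mulP p B) → Dvd A B
  dvd-cancel {p} {d} {A} {B} deg-p (h ,d pB≋) = h ,d monic-cancelˡ d p deg-p B (mulP A h) (≋-trans pB≋ (mul-assoc p A h))

  dvd-remainder-mul : ∀ {P f Q g R} h → f ≋ addP (mulP Q g) R → Dvd P (mulP f h) → Dvd P (mulP g h) →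
    Dvd P (mulP R h)
  dvd-remainder-mul {f = f} {Q} {g} {R} h f≋ P∣fh P∣gh =
    dvd-resp (≋-sym (remainder-mul {f} {Q} {g} {R} h f≋)) (dvd-add P∣fh (dvd-neg (dvd-mulˡ Q P∣gh)))

  MonicIrreducible : Poly → ℕ → Set
  MonicIrreducible P d = Deg P d 𝟙 × (1 ≤ d) × (∀ i g → Deg g i 𝟙 → 1 ≤ i → i < d → ¬ Dvd g P)

  -- Induction on deg r: normalise r to be monic and divide P by it; the remainder r₂
  -- is nonzero (r does not divide P), has smaller degree, and again P ∣ r₂·g.
  irreducible-divides-cofactor : ∀ {P d} → MonicIrreducible P d → ∀ B r g → Below r B → ¬ (r ≋ []) → Below r d →
    Dvd P (mulP r g) → Dvd P g
  irreducible-divides-cofactor irr zero r g below r≉0 _ _ = ⊥-elim (r≉0 (Below-zero below))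
  irreducible-divides-cofactor {P} {d} irr@(deg-P , _ , no-small) (suc B) r g below r≉0 below-d P∣rg
    with leading r r≉0
  ... | k , c , c≢0 , deg-r with inverse c c≢0
  ...   | c⁻¹ , cc⁻¹≡1 = by-degree k refl
    where
    k<d : k < d
    k<d = Deg<Below {r} c≢0 deg-r below-d
    k≤B : k ≤ B
    k≤B = ≤-pred (Deg<Below {r} c≢0 deg-r below)
    r₁ = scal c⁻¹ r
    deg-r₁ : Deg r₁ k 𝟙
    deg-r₁ = (λ n k<n → trans (coeff-scal c⁻¹ r n) (trans (cong (c⁻¹ ⊛_) (proj₁ deg-r n k<n)) (zeroʳ c⁻¹))) ,
             trans (coeff-scal c⁻¹ r k) (trans (cong (c⁻¹ ⊛_) (proj₂ deg-r)) (trans (*-comm c⁻¹ c) cc⁻¹≡1))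
    P∣r₁g : Dvd P (mulP r₁ g)
    P∣r₁g = dvd-resp (≋-sym (mul-scal c⁻¹ r g)) (dvd-scal c⁻¹ P∣rg)
    by-degree : ∀ k′ → k′ ≡ k → Dvd P g
    by-degree zero refl = dvd-resp (≋-trans (mul-congˡ g (≋monic-lowerCoeffs zero r₁ deg-r₁)) (mul-idˡ g)) P∣r₁g
    by-degree (suc _) refl with divide k r₁ deg-r₁ P
    ... | s , r₂ , P≋ , below-r₂ with ≋[]? r₂
    ...   | yes r₂≋0 = ⊥-elim (no-small k r₁ deg-r₁ (s≤s z≤n) k<d
                                 (s ,d ≋-trans P≋ (≋-trans (add-≋[]ʳ r₂≋0) (mul-comm s r₁))))
    ...   | no r₂≉0 = irreducible-divides-cofactor irr B r₂ g (Below-mono {r₂} k≤B below-r₂) r₂≉0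
                        (Below-mono {r₂} (<⇒≤ k<d) below-r₂) (dvd-remainder-mul {Q = s} {r₁} g P≋ (dvd-mulʳ g dvd-refl) P∣r₁g)

  irreducible-prime : ∀ {P d} → MonicIrreducible P d → ∀ a b → Dvd P (mulP a b) → Dvd P a ⊎ Dvd P b
  irreducible-prime {P} {d} irr@(deg-P , _ , _) a b P∣ab with divide d P deg-P a
  ... | Q , R , a≋ , below with ≋[]? R
  ...   | yes R≋0 = inj₁ (Q ,d ≋-trans a≋ (≋-trans (add-≋[]ʳ R≋0) (mul-comm Q P)))
  ...   | no R≉0 = inj₂ (irreducible-divides-cofactor irr d R b below R≉0 below
                          (dvd-remainder-mul {Q = Q} {P} b a≋ P∣ab (dvd-mulʳ b dvd-refl)))

module Counting (𝔽 : Fields.DiscreteField) (E : Fields.Enumeration 𝔽) where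
  -- The left side sums deg f over all q^n monic f of degree n; the right side counts,
  -- for each f, its irreducible factors P with multiplicity, each weighted by deg P.

  open Fields using (DiscreteField; Enumeration)
  open Polynomials 𝔽
  open DiscreteField 𝔽 using (K; _≟_; 𝟙≢𝟘)
  open Enumeration E
  open DivisorSums using (sumTo; sumTo-cong; sumTo-+; sumTo-0; sumTo-extend; sumTo-delta;
                                 𝕀; 𝕀-yes; 𝕀-no; 𝕀-cong; 𝕀≡; multiples; multiples-≤; multiples->; weightedCount)
  open ListSums
  open import Data.Nat using (ℕ; zero; suc; _≤_; _<_; z≤n; s≤s; _∸_; _^_; _⊔_; _≤?_; pred; >-nonZero)
    renaming (_+_ to _+ℕ_; _*_ to _*ℕ_)
  open import Data.Nat.Properties as ℕ
    using (≤-refl; ≤-trans; <-≤-trans; m≤n+m; <⇒≱; ≤-pred; m≤n⇒m⊔n≡n; suc-injective;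
           +-comm; +-assoc; m∸n+n≡m; <⇒≢; n≤1+n; m≤n⇒m≤1+n; +-cancelˡ-≡; m+[n∸m]≡n; m<m+n; m<n⇒0<n∸m;
           m≤n⇒m<n∨m≡n; n∸n≡0)
  open import Data.List using (List; []; _∷_; length; cartesianProductWith; filter; map)
  open import Data.List.Membership.Propositional using (_∈_)
  open import Data.List.Relation.Unary.Unique.Propositional using (Unique)
  import Data.List.Properties as List
  open import Data.List.Membership.Propositional using (lose)
  open import Data.List.Membership.Propositional.Properties
    using (∈-cartesianProductWith⁺; ∈-filter⁺; ∈-filter⁻; ∈-map⁺; ∈-map⁻)
  open import Data.List.Relation.Unary.Any using (here; any?; satisfied)
  open import Data.List.Relation.Unary.All using ([])
  open import Data.List.Relation.Unary.AllPairs using ([]; _∷_)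
  open import Data.List.Relation.Unary.Unique.Propositional.Properties using (cartesianProductWith⁺; filter⁺; map⁺)
  open import Data.Vec using (Vec) renaming ([] to []v; _∷_ to _∷v_)
  import Data.Vec.Properties as Vec
  open import Data.Product using (Σ; _×_; _,_; proj₁; proj₂)
  open import Data.Sum using (_⊎_; inj₁; inj₂)
  open import Data.Empty using (⊥; ⊥-elim)
  open import Relation.Nullary using (¬_; Dec; yes; no)
  open import Relation.Binary.Definitions using (DecidableEquality)
  open import Relation.Binary.PropositionalEquality

  q : ℕ
  q = length elements

  -- All coefficient vectors of length n, i.e. all monic polynomials of degree n.
  vectors : ∀ n → List (Vec K n)
  vectors zero = []v ∷ []
  vectors (suc n) = cartesianProductWith _∷v_ elements (vectors n)

  vectors-complete : ∀ n (v : Vec K n) → v ∈ vectors n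
  vectors-complete zero []v = here refl
  vectors-complete (suc n) (a ∷v v) = ∈-cartesianProductWith⁺ _∷v_ (elements-complete a) (vectors-complete n v)

  vectors-unique : ∀ n → Unique (vectors n)
  vectors-unique zero = [] ∷ []
  vectors-unique (suc n) = cartesianProductWith⁺ _∷v_ Vec.∷-injective elements-unique (vectors-unique n)

  vectors-length : ∀ n → length (vectors n) ≡ q ^ n
  vectors-length zero = refl
  vectors-length (suc n) =
    trans (length-cartesianProductWith _∷v_ elements (vectors n)) (cong (q *ℕ_) (vectors-length n))

  _≟v_ : ∀ {n} → DecidableEquality (Vec K n)
  _≟v_ = Vec.≡-dec _≟_

  _≟l_ : DecidableEquality (List K)
  _≟l_ = List.≡-dec _≟_

  -- A product of monic polynomials of degrees i and j is a list of length exactly i + j + 1,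
  -- so coefficientwise equality between monic polynomials is list equality.
  length-monic : ∀ {n} (v : Vec K n) → length (monicP v) ≡ suc n
  length-monic []v = refl
  length-monic (a ∷v v) = cong suc (length-monic v)

  ≋⇒≡ : ∀ f g → length f ≡ length g → f ≋ g → f ≡ g
  ≋⇒≡ [] [] _ _ = refl
  ≋⇒≡ (a ∷ f) (b ∷ g) same-length f≋g = cong₂ _∷_ (≋-head f≋g) (≋⇒≡ f g (suc-injective same-length) (≋-tail f≋g))

  length-add : ∀ f g → length (addP f g) ≡ length f ⊔ length g
  length-add [] g = refl
  length-add (a ∷ f) [] = refl
  length-add (a ∷ f) (b ∷ g) = cong suc (length-add f g)

  length-mul : ∀ a A b B → length (mulP (a ∷ A) (b ∷ B)) ≡ suc (length A +ℕ length B)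
  length-mul a [] b B = cong suc (trans (length-add (map (a ⊛_) B) [])
    (trans (ℕ.⊔-identityʳ (length (map (a ⊛_) B))) (List.length-map (a ⊛_) B)))
  length-mul a (a′ ∷ A) b B = cong suc (trans (length-add (map (a ⊛_) B) (mulP (a′ ∷ A) (b ∷ B)))
    (trans (cong₂ _⊔_ (List.length-map (a ⊛_) B) (length-mul a′ A b B))
           (m≤n⇒m⊔n≡n (≤-trans (m≤n+m (length B) (length A)) (n≤1+n _)))))

  length-mul-monic : ∀ {i j} (a : Vec K i) (b : Vec K j) → length (mulP (monicP a) (monicP b)) ≡ suc (i +ℕ j)
  length-mul-monic {i} {j} a b = from-lengths (monicP a) (monicP b) (length-monic a) (length-monic b)
    where
    from-lengths : ∀ A B → length A ≡ suc i → length B ≡ suc j → length (mulP A B) ≡ suc (i +ℕ j)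
    from-lengths (x ∷ A) (y ∷ B) lA lB =
      trans (length-mul x A y B) (cong suc (cong₂ _+ℕ_ (suc-injective lA) (suc-injective lB)))

  monicP-injective : ∀ {n} (a b : Vec K n) → monicP a ≡ monicP b → a ≡ b
  monicP-injective []v []v _ = refl
  monicP-injective (x ∷v a) (y ∷v b) e =
    cong₂ _∷v_ (List.∷-injectiveˡ e) (monicP-injective a b (List.∷-injectiveʳ e))

  monic≋⇒≡ : ∀ {i j} (a : Vec K i) (b : Vec K j) → monicP a ≋ monicP b → monicP a ≡ monicP b
  monic≋⇒≡ a b a≋b with Deg-unique {monicP a} 𝟙≢𝟘 𝟙≢𝟘 (Deg-monic a) (Deg-cong (≋-sym a≋b) (Deg-monic b))
  ... | refl , _ = ≋⇒≡ (monicP a) (monicP b) (trans (length-monic a) (sym (length-monic b))) a≋b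

  IrreducibleVec : ∀ n → Vec K n → Set
  IrreducibleVec n v = (1 ≤ n) × ¬ (Σ ℕ λ i → Σ ℕ λ j → (1 ≤ i) × (1 ≤ j) ×
    Σ (i +ℕ j ≡ n) λ _ → Σ (Vec K i) λ a → Σ (Vec K j) λ b → mulP (monicP a) (monicP b) ≡ monicP v)

  NoSmallDivisor : ℕ → Poly → Set
  NoSmallDivisor n f = ∀ i (a : Vec K i) → 1 ≤ i → i < n → ¬ Dvd (monicP a) f

  NoSmallDivisor⇒IrreducibleVec : ∀ n v → 1 ≤ n → NoSmallDivisor n (monicP v) → IrreducibleVec n v
  NoSmallDivisor⇒IrreducibleVec n v 1≤n no-small = 1≤n , λ { (i , j , 1≤i , 1≤j , refl , a , b , ab≡v) →
    no-small i a 1≤i (m<m+n i 1≤j) (monicP b ,d ≋-sym (≡⇒≋ ab≡v)) }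

  IrreducibleVec⇒NoSmallDivisor : ∀ n v → IrreducibleVec n v → NoSmallDivisor n (monicP v)
  IrreducibleVec⇒NoSmallDivisor n v (_ , no-factorisation) i a 1≤i i<n (w ,d v≋aw)
    with quotient-degree i n (monicP a) (monicP v) w (Deg-monic a) (Deg-monic v) v≋aw
  ... | i≤n , deg-w = no-factorisation (i , n ∸ i , 1≤i , m<n⇒0<n∸m i<n , m+[n∸m]≡n i≤n , a , b ,
        ≋⇒≡ _ _ (trans (length-mul-monic a b) (trans (cong suc (m+[n∸m]≡n i≤n)) (sym (length-monic v))))
              (≋-sym (≋-trans v≋aw (mul-congʳ (monicP a) (≋monic-lowerCoeffs (n ∸ i) w deg-w)))))
    where
    b = lowerCoeffs (n ∸ i) w

  NoSmallDivisor⇒MonicIrreducible : ∀ n v → 1 ≤ n → NoSmallDivisor n (monicP v) → MonicIrreducible (monicP v) n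
  NoSmallDivisor⇒MonicIrreducible n v 1≤n no-small = Deg-monic v , 1≤n , λ i g deg-g 1≤i i<n g∣v →
    no-small i (lowerCoeffs i g) 1≤i i<n (dvd-respˡ (≋monic-lowerCoeffs i g deg-g) g∣v)

  IrreducibleVec⇒MonicIrreducible : ∀ n v → IrreducibleVec n v → MonicIrreducible (monicP v) n
  IrreducibleVec⇒MonicIrreducible n v irr =
    NoSmallDivisor⇒MonicIrreducible n v (proj₁ irr) (IrreducibleVec⇒NoSmallDivisor n v irr)

  SmallDivisor : ℕ → Poly → Set
  SmallDivisor n f = Σ ℕ λ i → Σ (Vec K i) λ a → (1 ≤ i) × (i < n) × Dvd (monicP a) f

  search-divisor : ∀ n f → SmallDivisor n f ⊎ NoSmallDivisor n f
  search-divisor zero f = inj₂ λ i a _ ()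
  search-divisor (suc n) f with search-divisor n f
  ... | inj₁ (i , a , 1≤i , i<n , a∣f) = inj₁ (i , a , 1≤i , m≤n⇒m≤1+n i<n , a∣f)
  ... | inj₂ none-below-n with 1 ≤? n
  ...   | no n≱1 = inj₂ λ i a 1≤i i<1+n _ → n≱1 (≤-trans 1≤i (≤-pred i<1+n))
  ...   | yes 1≤n with any? (λ a → dvd? n (monicP a) (Deg-monic a) f) (vectors n)
  ...     | yes found = inj₁ (n , proj₁ (satisfied found) , 1≤n , ≤-refl , proj₂ (satisfied found))
  ...     | no none-of-degree-n = inj₂ λ i a 1≤i i<1+n a∣f → by-degree i a 1≤i (m≤n⇒m<n∨m≡n (≤-pred i<1+n)) a∣f
    where
    by-degree : ∀ i (a : Vec K i) → 1 ≤ i → (i < n ⊎ i ≡ n) → Dvd (monicP a) f → ⊥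
    by-degree i a 1≤i (inj₁ i<n) a∣f = none-below-n i a 1≤i i<n a∣f
    by-degree i a 1≤i (inj₂ refl) a∣f = none-of-degree-n (lose (vectors-complete i a) a∣f)

  irreducible? : ∀ n (v : Vec K n) → Dec (IrreducibleVec n v)
  irreducible? n v with 1 ≤? n
  ... | no n≱1 = no λ irr → n≱1 (proj₁ irr)
  ... | yes 1≤n with search-divisor n (monicP v)
  ...   | inj₂ no-small = yes (NoSmallDivisor⇒IrreducibleVec n v 1≤n no-small)
  ...   | inj₁ (i , a , 1≤i , i<n , a∣v) = no λ irr → IrreducibleVec⇒NoSmallDivisor n v irr i a 1≤i i<n a∣v

  irreducibles : ∀ d → List (Vec K d)
  irreducibles d = filter (irreducible? d) (vectors d)

  irreducibles-unique : ∀ d → Unique (irreducibles d)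
  irreducibles-unique d = filter⁺ (irreducible? d) (vectors-unique d)

  ∈-irreducibles : ∀ {d} {P : Vec K d} → P ∈ irreducibles d → IrreducibleVec d P
  ∈-irreducibles {d} P∈ = proj₂ (∈-filter⁻ (irreducible? d) {xs = vectors d} P∈)

  N : ℕ → ℕ
  N d = length (irreducibles d)

  record IrreducibleFactor (n : ℕ) (F : Poly) : Set where
    constructor irreducibleFactor
    field
      d₀       : ℕ
      P₀       : Vec K d₀
      P₀-irr   : IrreducibleVec d₀ P₀
      cofactor : Poly
      deg-cofactor : Deg cofactor (n ∸ d₀) 𝟙
      F≋P₀*cofactor : F ≋ mulP (monicP P₀) cofactor
      d₀≤n     : d₀ ≤ n

  ∸-telescope : ∀ {d i n} → d ≤ i → i ≤ n → i ∸ d +ℕ (n ∸ i) ≡ n ∸ d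
  ∸-telescope {d} {i} {n} d≤i i≤n = +-cancelˡ-≡ d _ _ (begin
    d +ℕ (i ∸ d +ℕ (n ∸ i))  ≡⟨ sym (+-assoc d (i ∸ d) (n ∸ i)) ⟩
    d +ℕ (i ∸ d) +ℕ (n ∸ i)  ≡⟨ cong (_+ℕ (n ∸ i)) (m+[n∸m]≡n d≤i) ⟩
    i +ℕ (n ∸ i)             ≡⟨ m+[n∸m]≡n i≤n ⟩
    n                        ≡⟨ sym (m+[n∸m]≡n (≤-trans d≤i i≤n)) ⟩
    d +ℕ (n ∸ d)             ∎)
    where open ≡-Reasoning

  -- If F has no small monic divisor it is itself irreducible; otherwise recurse into a
  -- small divisor (B bounds the degree).
  irreducible-factor : ∀ B n F → n < B → Deg F n 𝟙 → 1 ≤ n → IrreducibleFactor n F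
  irreducible-factor (suc B) n F n<B deg-F 1≤n with search-divisor n F
  ... | inj₂ no-small = irreducibleFactor n v
          (NoSmallDivisor⇒IrreducibleVec n v 1≤n (λ i a 1≤i i<n a∣v → no-small i a 1≤i i<n (dvd-resp (≋-sym F≋v) a∣v)))
          oneP (subst (λ z → Deg oneP z 𝟙) (sym (n∸n≡0 n)) Deg-one) (≋-trans F≋v (≋-sym (mul-idʳ (monicP v)))) ≤-refl
    where
    v = lowerCoeffs n F
    F≋v : F ≋ monicP v
    F≋v = ≋monic-lowerCoeffs n F deg-F
  ... | inj₁ (i , a , 1≤i , i<n , (w ,d F≋aw)) with quotient-degree i n (monicP a) F w (Deg-monic a) deg-F F≋aw
  ...   | i≤n , deg-w with irreducible-factor B i (monicP a) (<-≤-trans i<n (≤-pred n<B)) (Deg-monic a) 1≤i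
  ...     | irreducibleFactor d₀ P₀ P₀-irr a′ deg-a′ a≋P₀a′ d₀≤i =
    irreducibleFactor d₀ P₀ P₀-irr (mulP a′ w)
      (subst (λ z → Deg (mulP a′ w) z 𝟙) (∸-telescope d₀≤i i≤n) (Deg-mul-monic a′ w deg-a′ deg-w))
      (≋-trans F≋aw (≋-trans (mul-congˡ w a≋P₀a′) (mul-assoc (monicP P₀) a′ w))) (≤-trans d₀≤i i≤n)

  powP : Poly → ℕ → Poly
  powP p zero = oneP
  powP p (suc k) = mulP p (powP p k)

  Deg-pow : ∀ {p d} → Deg p d 𝟙 → ∀ k → Deg (powP p k) (k *ℕ d) 𝟙
  Deg-pow deg-p zero = Deg-one
  Deg-pow {p} deg-p (suc k) = Deg-mul-monic p (powP p k) deg-p (Deg-pow deg-p k)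

  power-divides-cofactor : ∀ {p d p₀ d₀} → MonicIrreducible p d → MonicIrreducible p₀ d₀ → ¬ (p ≋ p₀) →
    ∀ k F′ → Dvd (powP p k) (mulP p₀ F′) → Dvd (powP p k) F′
  power-divides-cofactor _ _ _ zero F′ _ = dvd-one F′
  power-divides-cofactor {p} {d} {p₀} {d₀} irr@(deg-p , 1≤d , _) irr₀@(deg-p₀ , _ , no-small₀) p≉p₀ (suc k) F′ p^k+1∣
    with irreducible-prime irr p₀ F′ (dvd-trans (powP p k ,d ≋-refl) p^k+1∣)
  ... | inj₁ (w ,d p₀≋pw) = ⊥-elim (p≉p₀ (≋-sym p₀≋p))
    where
    p₀≋p : p₀ ≋ p
    p₀≋p with quotient-degree d d₀ p p₀ w deg-p deg-p₀ p₀≋pw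
    ... | d≤d₀ , deg-w with m≤n⇒m<n∨m≡n d≤d₀
    ...   | inj₁ d<d₀ = ⊥-elim (no-small₀ d p deg-p 1≤d d<d₀ (w ,d p₀≋pw))
    ...   | inj₂ refl = ≋-trans p₀≋pw (≋-trans (mul-congʳ p (≋monic-lowerCoeffs 0 w
                          (subst (λ z → Deg w z 𝟙) (n∸n≡0 d) deg-w))) (mul-idʳ p))
  ... | inj₂ (w ,d F′≋pw) = dvd-resp (≋-sym F′≋pw) (dvd-mul-both p p^k∣w)
    where
    p₀F′≋ : mulP p₀ F′ ≋ mulP p (mulP p₀ w)
    p₀F′≋ = ≋-trans (mul-congʳ p₀ F′≋pw) (≋-trans (≋-sym (mul-assoc p₀ p w))
              (≋-trans (mul-congˡ w (mul-comm p₀ p)) (mul-assoc p p₀ w)))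
    p^k∣w : Dvd (powP p k) w
    p^k∣w = power-divides-cofactor irr irr₀ p≉p₀ k w (dvd-cancel {p} deg-p (dvd-resp p₀F′≋ p^k+1∣))

  high-power∤ : ∀ {p₀ d₀ F′ m} M → Deg p₀ d₀ 𝟙 → 1 ≤ d₀ → Deg F′ m 𝟙 → m < M → ¬ Dvd (powP p₀ M) F′
  high-power∤ {p₀} {d₀} {F′} {m} M deg-p₀ 1≤d₀ deg-F′ m<M (w ,d F′≋)
    with quotient-degree (M *ℕ d₀) m (powP p₀ M) F′ w (Deg-pow deg-p₀ M) deg-F′ F′≋
  ... | Md₀≤m , _ = <⇒≱ (<-≤-trans m<M (ℕ.m≤m*n M d₀ {{>-nonZero 1≤d₀}})) Md₀≤m

  dvd-pow? : ∀ {d} (P : Vec K d) k F → Dec (Dvd (powP (monicP P) k) F)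
  dvd-pow? {d} P k F = dvd? (k *ℕ d) (powP (monicP P) k) (Deg-pow (Deg-monic P) k) F

  -- The multiplicity of P in F, counted as #{1 ≤ k ≤ M : P^k ∣ F}.
  multiplicity : ℕ → ∀ {d} → Vec K d → Poly → ℕ
  multiplicity M P F = sumTo M (λ k → 𝕀 (dvd-pow? P k F))

  totalMultiplicity : ℕ → Poly → ℕ
  totalMultiplicity M F = sumTo M (λ d → d *ℕ listSum (irreducibles d) (λ P → multiplicity M P F))

  sumTo-shift : ∀ M (b : ℕ → ℕ) → sumTo M (λ k → b (pred k)) +ℕ b M ≡ b 0 +ℕ sumTo M b
  sumTo-shift zero b = sym (ℕ.+-identityʳ (b 0))
  sumTo-shift (suc M) b =
    trans (cong (_+ℕ b (suc M)) (sumTo-shift M b)) (+-assoc (b 0) (sumTo M b) (b (suc M)))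

  multiplicity-step : ∀ M {d₀} (P₀ : Vec K d₀) → IrreducibleVec d₀ P₀ → ∀ {m} F F′ → Deg F′ m 𝟙 → m < M →
    F ≋ mulP (monicP P₀) F′ → ∀ {d} (P : Vec K d) → IrreducibleVec d P →
    multiplicity M P F ≡ multiplicity M P F′ +ℕ 𝕀 (monicP P ≟l monicP P₀)
  multiplicity-step M {d₀} P₀ irr₀ F F′ deg-F′ m<M F≋ {d} P irr with monicP P ≟l monicP P₀
  ... | no P≢P₀ = trans (sumTo-cong M (λ k _ _ → 𝕀-cong
          (λ P^k∣F → power-divides-cofactor (IrreducibleVec⇒MonicIrreducible d P irr)
                       (IrreducibleVec⇒MonicIrreducible d₀ P₀ irr₀) (λ P≋P₀ → P≢P₀ (monic≋⇒≡ P P₀ P≋P₀)) k F′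
                       (dvd-resp F≋ P^k∣F))
          (λ P^k∣F′ → dvd-resp (≋-sym F≋) (dvd-mulˡ (monicP P₀) P^k∣F′))
          (dvd-pow? P k F) (dvd-pow? P k F′))) (sym (ℕ.+-identityʳ _))
  ... | yes P≡P₀ = begin
    sumTo M (λ k → 𝕀 (dvd-pow? P k F))     ≡⟨ sumTo-cong M (λ k 1≤k _ → shifted k 1≤k) ⟩
    sumTo M (λ k → b (pred k))              ≡⟨ sym (ℕ.+-identityʳ _) ⟩
    sumTo M (λ k → b (pred k)) +ℕ 0         ≡⟨ cong (sumTo M (λ k → b (pred k)) +ℕ_) (sym b-M) ⟩
    sumTo M (λ k → b (pred k)) +ℕ b M       ≡⟨ sumTo-shift M b ⟩
    b 0 +ℕ sumTo M b                        ≡⟨ cong (_+ℕ sumTo M b) b-0 ⟩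
    1 +ℕ sumTo M b                          ≡⟨ +-comm 1 (sumTo M b) ⟩
    sumTo M b +ℕ 1                          ∎
    where
    open ≡-Reasoning
    p = monicP P
    b : ℕ → ℕ
    b k = 𝕀 (dvd-pow? P k F′)
    F≋pF′ : F ≋ mulP p F′
    F≋pF′ = subst (λ z → F ≋ mulP z F′) (sym P≡P₀) F≋
    -- p^k ∣ p·F′  iff  p^(k-1) ∣ F′.
    shifted : ∀ k → 1 ≤ k → 𝕀 (dvd-pow? P k F) ≡ b (pred k)
    shifted (suc k) _ = 𝕀-cong (λ p^k+1∣F → dvd-cancel {p} (Deg-monic P) (dvd-resp F≋pF′ p^k+1∣F))
                               (λ p^k∣F′ → dvd-resp (≋-sym F≋pF′) (dvd-mul-both p p^k∣F′))
                               (dvd-pow? P (suc k) F) (dvd-pow? P k F′)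
    b-M : b M ≡ 0
    b-M = 𝕀-no (high-power∤ M (Deg-monic P) (proj₁ irr) deg-F′ m<M) (dvd-pow? P M F′)
    b-0 : b 0 ≡ 1
    b-0 = 𝕀-yes (dvd-one F′) (dvd-pow? P 0 F′)

  degree-of-irreducible : ∀ M {d₀} (P₀ : Vec K d₀) → IrreducibleVec d₀ P₀ → d₀ ≤ M →
    sumTo M (λ d → d *ℕ listSum (irreducibles d) (λ P → 𝕀 (monicP P ≟l monicP P₀))) ≡ d₀
  degree-of-irreducible M {d₀} P₀ irr₀ d₀≤M = trans (sumTo-cong M term)
    (trans (sumTo-extend d₀ M d₀≤M (λ d d₀<d → trans (cong (d *ℕ_) (𝕀-no (λ d≡d₀ → <⇒≢ d₀<d (sym d≡d₀)) (d ℕ.≟ d₀)))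
                                                      (ℕ.*-zeroʳ d)))
           (sumTo-delta d₀ (λ d → d) (proj₁ irr₀)))
    where
    term : ∀ d → 1 ≤ d → d ≤ M →
      d *ℕ listSum (irreducibles d) (λ P → 𝕀 (monicP P ≟l monicP P₀)) ≡ d *ℕ 𝕀≡ d d₀
    term d _ _ with d ℕ.≟ d₀
    ... | yes refl = cong (d *ℕ_)
      (trans (listSum-cong (irreducibles d) (λ P _ →
                𝕀-cong (monicP-injective P P₀) (cong monicP) (monicP P ≟l monicP P₀) (P ≟v P₀)))
             (listSum-𝕀≡ _≟v_ (irreducibles d) P₀ (irreducibles-unique d) (∈-filter⁺ (irreducible? d) (vectors-complete d P₀) irr₀)))
    ... | no d≢d₀ = cong (d *ℕ_) (listSum-0 (irreducibles d) (λ P _ → 𝕀-no (different-degree P) (monicP P ≟l monicP P₀)))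
      where
      different-degree : ∀ P → ¬ monicP P ≡ monicP P₀
      different-degree P P≡P₀ = d≢d₀ (suc-injective (trans (sym (length-monic P)) (trans (cong length P≡P₀) (length-monic P₀))))

  multiplicity-const : ∀ M F → Deg F 0 𝟙 → ∀ {d} (P : Vec K d) → IrreducibleVec d P → multiplicity M P F ≡ 0
  multiplicity-const M F deg-F {d} P irr = sumTo-0 M λ k 1≤k _ → 𝕀-no (P^k∤F k 1≤k) (dvd-pow? P k F)
    where
    P^k∤F : ∀ k → 1 ≤ k → ¬ Dvd (powP (monicP P) k) F
    P^k∤F k 1≤k (w ,d F≋) with quotient-degree (k *ℕ d) 0 (powP (monicP P) k) F w (Deg-pow (Deg-monic P) k) deg-F F≋
    ... | kd≤0 , _ = <⇒≱ (ℕ.*-mono-≤ 1≤k (proj₁ irr)) kd≤0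

  -- deg F = Σ_d d · Σ_{P ∈ Irr(d)} multiplicity of P in F,  for F monic of degree n ≤ M.
  -- Induction on n (bounded by B): split off an irreducible factor P₀.
  degree-as-multiplicity : ∀ M B n F → n < B → Deg F n 𝟙 → n ≤ M → totalMultiplicity M F ≡ n
  degree-as-multiplicity M B zero F _ deg-F _ = sumTo-0 M λ d _ _ →
    trans (cong (d *ℕ_) (listSum-0 (irreducibles d) (λ P P∈ → multiplicity-const M F deg-F P (∈-irreducibles P∈))))
          (ℕ.*-zeroʳ d)
  degree-as-multiplicity M (suc B) (suc n) F n<B deg-F n≤M
    with irreducible-factor (suc B) (suc n) F n<B deg-F (s≤s z≤n)
  ... | irreducibleFactor d₀ P₀ P₀-irr F′ deg-F′ F≋ d₀≤n = begin
    totalMultiplicity M F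
      ≡⟨ sumTo-cong M (λ d _ _ → cong (d *ℕ_) (listSum-cong (irreducibles d) (λ P P∈ →
           multiplicity-step M P₀ P₀-irr F F′ deg-F′ m<M F≋ P (∈-irreducibles P∈)))) ⟩
    sumTo M (λ d → d *ℕ listSum (irreducibles d) (λ P → multiplicity M P F′ +ℕ is-P₀ P))
      ≡⟨ sumTo-cong M (λ d _ _ → trans (cong (d *ℕ_) (listSum-+ (irreducibles d) _ _)) (ℕ.*-distribˡ-+ d _ _)) ⟩
    sumTo M (λ d → d *ℕ listSum (irreducibles d) (λ P → multiplicity M P F′) +ℕ d *ℕ listSum (irreducibles d) is-P₀)
      ≡⟨ sumTo-+ M _ _ ⟩
    totalMultiplicity M F′ +ℕ sumTo M (λ d → d *ℕ listSum (irreducibles d) is-P₀)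
      ≡⟨ cong₂ _+ℕ_ (degree-as-multiplicity M B (suc n ∸ d₀) F′ m<B deg-F′ (≤-trans (ℕ.m∸n≤m (suc n) d₀) n≤M))
                    (degree-of-irreducible M P₀ P₀-irr (≤-trans d₀≤n n≤M)) ⟩
    suc n ∸ d₀ +ℕ d₀
      ≡⟨ m∸n+n≡m d₀≤n ⟩
    suc n ∎
    where
    open ≡-Reasoning
    is-P₀ : ∀ {d} → Vec K d → ℕ
    is-P₀ P = 𝕀 (monicP P ≟l monicP P₀)
    m<n : suc n ∸ d₀ < suc n
    m<n = ℕ.∸-monoʳ-< {suc n} {d₀} {0} (proj₁ P₀-irr) d₀≤n
    m<M : suc n ∸ d₀ < M
    m<M = <-≤-trans m<n n≤M
    m<B : suc n ∸ d₀ < B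
    m<B = <-≤-trans m<n (≤-pred n<B)

  module MultiplyBy {n e} (g : Poly) (deg-g : Deg g e 𝟙) (e≤n : e ≤ n) where

    deg-product : ∀ w → Deg (mulP g (monicP w)) n 𝟙
    deg-product w = subst (λ z → Deg (mulP g (monicP w)) z 𝟙) (m+[n∸m]≡n e≤n) (Deg-mul-monic g (monicP w) deg-g (Deg-monic w))

    times-g : Vec K (n ∸ e) → Vec K n
    times-g w = lowerCoeffs n (mulP g (monicP w))

    times-g-spec : ∀ w → mulP g (monicP w) ≋ monicP (times-g w)
    times-g-spec w = ≋monic-lowerCoeffs n (mulP g (monicP w)) (deg-product w)

    times-g-injective : ∀ {w w′} → times-g w ≡ times-g w′ → w ≡ w′
    times-g-injective {w} {w′} gw≡gw′ = monicP-injective w w′ (monic≋⇒≡ w w′ (monic-cancelˡ e g deg-g (monicP w) (monicP w′)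
      (≋-trans (times-g-spec w) (≋-trans (≡⇒≋ (cong monicP gw≡gw′)) (≋-sym (times-g-spec w′))))))

    multiple⇒image : ∀ v → Dvd g (monicP v) → Σ (Vec K (n ∸ e)) λ w → v ≡ times-g w
    multiple⇒image v (h ,d v≋gh) with quotient-degree e n g (monicP v) h deg-g (Deg-monic v) v≋gh
    ... | _ , deg-h = w , monicP-injective v (times-g w) (monic≋⇒≡ v (times-g w)
                          (≋-trans v≋gh (≋-trans (mul-congʳ g (≋monic-lowerCoeffs (n ∸ e) h deg-h)) (times-g-spec w))))
      where
      w = lowerCoeffs (n ∸ e) h

  count-multiples : ∀ n e g → Deg g e 𝟙 → (g∣? : ∀ (v : Vec K n) → Dec (Dvd g (monicP v))) →
    listSum (vectors n) (λ v → 𝕀 (g∣? v)) ≡ multiples q n e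
  count-multiples n e g deg-g g∣? = by-cases (e ≤? n)
    where
    by-cases : Dec (e ≤ n) → listSum (vectors n) (λ v → 𝕀 (g∣? v)) ≡ multiples q n e
    by-cases (no e≰n) = trans (listSum-0 (vectors n) (λ v _ → 𝕀-no (g∤ v) (g∣? v))) (sym (multiples-> q n e e≰n))
      where
      g∤ : ∀ v → ¬ Dvd g (monicP v)
      g∤ v (w ,d v≋gw) = e≰n (proj₁ (quotient-degree e n g (monicP v) w deg-g (Deg-monic v) v≋gw))
    by-cases (yes e≤n) = begin
      listSum (vectors n) (λ v → 𝕀 (g∣? v))           ≡⟨ listSum-𝕀 g∣? (vectors n) ⟩
      length (filter g∣? (vectors n))                  ≡⟨ same-length (filter⁺ g∣? (vectors-unique n))
                                                            (map⁺ times-g-injective (vectors-unique (n ∸ e))) to from ⟩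
      length (map times-g (vectors (n ∸ e)))           ≡⟨ List.length-map times-g (vectors (n ∸ e)) ⟩
      length (vectors (n ∸ e))                         ≡⟨ vectors-length (n ∸ e) ⟩
      q ^ (n ∸ e)                                      ≡⟨ sym (multiples-≤ q n e e≤n) ⟩
      multiples q n e                                  ∎
      where
      open ≡-Reasoning
      open MultiplyBy g deg-g e≤n
      to : ∀ {v} → v ∈ filter g∣? (vectors n) → v ∈ map times-g (vectors (n ∸ e))
      to {v} v∈ with multiple⇒image v (proj₂ (∈-filter⁻ g∣? {xs = vectors n} v∈))
      ... | w , refl = ∈-map⁺ times-g (vectors-complete (n ∸ e) w)
      from : ∀ {v} → v ∈ map times-g (vectors (n ∸ e)) → v ∈ filter g∣? (vectors n)
      from v∈ with ∈-map⁻ times-g v∈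
      ... | w , _ , refl = ∈-filter⁺ g∣? (vectors-complete n (times-g w)) (monicP w ,d ≋-sym (times-g-spec w))

  -- Summing  deg f = totalMultiplicity f  over all monic f of degree n ≤ M.
  weighted-count : ∀ M n → n ≤ M → n *ℕ q ^ n ≡ weightedCount q N M n
  weighted-count M n n≤M = begin
    n *ℕ q ^ n
      ≡⟨ ℕ.*-comm n (q ^ n) ⟩
    q ^ n *ℕ n
      ≡⟨ cong (_*ℕ n) (sym (vectors-length n)) ⟩
    length (vectors n) *ℕ n
      ≡⟨ sym (listSum-const (vectors n) n) ⟩
    listSum (vectors n) (λ _ → n)
      ≡⟨ sym (listSum-cong (vectors n) (λ v _ → degree-as-multiplicity M (suc n) n (monicP v) ≤-refl (Deg-monic v) n≤M)) ⟩
    listSum (vectors n) (λ v → totalMultiplicity M (monicP v))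
      ≡⟨ listSum-sumTo (vectors n) M _ ⟩
    sumTo M (λ d → listSum (vectors n) (λ v → d *ℕ listSum (irreducibles d) (λ P → multiplicity M P (monicP v))))
      ≡⟨ sumTo-cong M (λ d _ _ → trans (listSum-*ˡ (vectors n) d _) (cong (d *ℕ_) (per-degree d))) ⟩
    weightedCount q N M n ∎
    where
    open ≡-Reasoning
    -- For each irreducible P of degree d and each k, count the f with P^k ∣ f.
    per-degree : ∀ d → listSum (vectors n) (λ v → listSum (irreducibles d) (λ P → multiplicity M P (monicP v)))
                       ≡ N d *ℕ sumTo M (λ k → multiples q n (k *ℕ d))
    per-degree d = trans (listSum-swap (vectors n) (irreducibles d) _)
      (trans (listSum-cong (irreducibles d) (λ P _ → trans (listSum-sumTo (vectors n) M _)
                (sumTo-cong M (λ k _ _ → count-multiples n (k *ℕ d) (powP (monicP P) k) (Deg-pow (Deg-monic P) k)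
                                                          (λ v → dvd-pow? P k (monicP v))))))
             (listSum-const (irreducibles d) _))

module StatementPolynomials where

  open import Defs using (FiniteField; module Poly)
  open Fields using (module FromFiniteField)
  open ListSums using (same-length)
  open import Data.Nat using (ℕ)
  open import Data.List using (List; []; _∷_; map)
  open import Data.List.Relation.Binary.Pointwise as Pointwise using (Pointwise; []; _∷_)
  open import Data.List.Membership.Propositional.Properties using (∈-filter⁺; ∈-filter⁻)
  open import Data.Vec using (Vec) renaming ([] to []v; _∷_ to _∷v_)
  import Data.Vec as Vec
  open import Data.Product using (_,_; proj₂)
  open import Relation.Binary.PropositionalEquality as ≡ using (_≡_)

  -- The statement's polynomials over F (setoid coefficients) versus the polynomials over
  -- the discrete field Fin q: the enumeration maps one to the other, preserving products
  -- and monic polynomials, hence irreducibility and the number of irreducibles.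
  module Compare {q : ℕ} (F : FiniteField q) where
    open FiniteField F using (Carrier; _≈_; _*_; setoid; +-cong; *-cong; refl; sym; trans; enum; enum-injective)
    open FromFiniteField F using (discreteField; enumeration; index; enum-index)
    open Polynomials discreteField using (addP; mulP; scal; monicP; 𝟘)
    open Counting discreteField enumeration
      using (IrreducibleVec; irreducible?; irreducibles-unique; vectors; vectors-complete; N)
    module D = Poly F

    open import Relation.Binary.Reasoning.Setoid (Pointwise.setoid setoid)

    addD-cong : ∀ {f f′ g g′} → D._≈P_ f f′ → D._≈P_ g g′ → D._≈P_ (D.addP f g) (D.addP f′ g′)
    addD-cong [] g≈ = g≈
    addD-cong (a≈ ∷ f≈) [] = a≈ ∷ f≈
    addD-cong (a≈ ∷ f≈) (b≈ ∷ g≈) = +-cong a≈ b≈ ∷ addD-cong f≈ g≈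

    scalD-cong : ∀ {a a′ g g′} → a ≈ a′ → D._≈P_ g g′ → D._≈P_ (map (a *_) g) (map (a′ *_) g′)
    scalD-cong a≈ [] = []
    scalD-cong a≈ (b≈ ∷ g≈) = *-cong a≈ b≈ ∷ scalD-cong a≈ g≈

    mulD-cong : ∀ {f f′ g g′} → D._≈P_ f f′ → D._≈P_ g g′ → D._≈P_ (D.mulP f g) (D.mulP f′ g′)
    mulD-cong [] g≈ = []
    mulD-cong (a≈ ∷ f≈) g≈ = addD-cong (scalD-cong a≈ g≈) (refl ∷ mulD-cong f≈ g≈)

    enum-add : ∀ f g → D._≈P_ (map enum (addP f g)) (D.addP (map enum f) (map enum g))
    enum-add [] g = Pointwise.refl refl
    enum-add (a ∷ f) [] = Pointwise.refl refl
    enum-add (a ∷ f) (b ∷ g) = enum-index _ ∷ enum-add f g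

    enum-scal : ∀ a g → D._≈P_ (map enum (scal a g)) (map (enum a *_) (map enum g))
    enum-scal a [] = []
    enum-scal a (b ∷ g) = enum-index _ ∷ enum-scal a g

    enum-mul : ∀ f g → D._≈P_ (map enum (mulP f g)) (D.mulP (map enum f) (map enum g))
    enum-mul [] g = []
    enum-mul (a ∷ f) g = begin
      map enum (mulP (a ∷ f) g)                                         ≈⟨ enum-add (scal a g) (𝟘 ∷ mulP f g) ⟩
      D.addP (map enum (scal a g)) (enum 𝟘 ∷ map enum (mulP f g))       ≈⟨ addD-cong (enum-scal a g) (enum-index _ ∷ enum-mul f g) ⟩
      D.mulP (map enum (a ∷ f)) (map enum g)                            ∎

    enum-monic : ∀ {n} (v : Vec _ n) → D._≈P_ (map enum (monicP v)) (D.monic (Vec.map enum v))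
    enum-monic []v = enum-index _ ∷ []
    enum-monic (a ∷v v) = refl ∷ enum-monic v

    enum-index-monic : ∀ {n} (a : Vec Carrier n) → D._≈P_ (D.monic (Vec.map enum (Vec.map index a))) (D.monic a)
    enum-index-monic []v = refl ∷ []
    enum-index-monic (x ∷v a) = enum-index x ∷ enum-index-monic a

    enum-injective-list : ∀ {xs ys} → D._≈P_ (map enum xs) (map enum ys) → xs ≡ ys
    enum-injective-list {xs} {ys} e =
      Pointwise.Pointwise-≡⇒≡ (Pointwise.map (enum-injective _ _) (Pointwise.map⁻ enum enum e))

    factorisation-to-F : ∀ {i j n} (a : Vec _ i) (b : Vec _ j) (c : Vec _ n) →
      mulP (monicP a) (monicP b) ≡ monicP c →
      D._≈P_ (D.mulP (D.monic (Vec.map enum a)) (D.monic (Vec.map enum b))) (D.monic (Vec.map enum c))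
    factorisation-to-F a b c ab≡c = begin
      D.mulP (D.monic (Vec.map enum a)) (D.monic (Vec.map enum b))   ≈⟨ mulD-cong (Pointwise.symmetric sym (enum-monic a))
                                                                                   (Pointwise.symmetric sym (enum-monic b)) ⟩
      D.mulP (map enum (monicP a)) (map enum (monicP b))             ≈⟨ Pointwise.symmetric sym (enum-mul (monicP a) (monicP b)) ⟩
      map enum (mulP (monicP a) (monicP b))                          ≡⟨ ≡.cong (map enum) ab≡c ⟩
      map enum (monicP c)                                            ≈⟨ enum-monic c ⟩
      D.monic (Vec.map enum c)                                       ∎

    factorisation-from-F : ∀ {i j n} (a′ : Vec Carrier i) (b′ : Vec Carrier j) (c : Vec _ n) →
      D._≈P_ (D.mulP (D.monic a′) (D.monic b′)) (D.monic (Vec.map enum c)) →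
      mulP (monicP (Vec.map index a′)) (monicP (Vec.map index b′)) ≡ monicP c
    factorisation-from-F a′ b′ c e = enum-injective-list (begin
      map enum (mulP (monicP a) (monicP b))                          ≈⟨ enum-mul (monicP a) (monicP b) ⟩
      D.mulP (map enum (monicP a)) (map enum (monicP b))             ≈⟨ mulD-cong (Pointwise.transitive trans (enum-monic a) (enum-index-monic a′))
                                                                                   (Pointwise.transitive trans (enum-monic b) (enum-index-monic b′)) ⟩
      D.mulP (D.monic a′) (D.monic b′)                               ≈⟨ e ⟩
      D.monic (Vec.map enum c)                                       ≈⟨ Pointwise.symmetric sym (enum-monic c) ⟩
      map enum (monicP c)                                            ∎)
      where
      a = Vec.map index a′
      b = Vec.map index b′

    irreducible-to-Fin : ∀ n c → D.IrredCode n c → IrreducibleVec n c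
    irreducible-to-Fin n c (1≤n , no-factorisation) = 1≤n , λ { (i , j , 1≤i , 1≤j , i+j≡n , a , b , ab≡c) →
      no-factorisation (i , j , 1≤i , 1≤j , i+j≡n , Vec.map enum a , Vec.map enum b , factorisation-to-F a b c ab≡c) }

    irreducible-to-F : ∀ n c → IrreducibleVec n c → D.IrredCode n c
    irreducible-to-F n c (1≤n , no-factorisation) = 1≤n , λ { (i , j , 1≤i , 1≤j , i+j≡n , a′ , b′ , e) →
      no-factorisation (i , j , 1≤i , 1≤j , i+j≡n , Vec.map index a′ , Vec.map index b′ , factorisation-from-F a′ b′ c e) }

    count≡N : ∀ n M → D.CountsIrreducible n M → M ≡ N n
    count≡N n M (xs , unique , sound , complete , length≡M) = ≡.trans (≡.sym length≡M)
      (same-length unique (irreducibles-unique n)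
        (λ {c} c∈ → ∈-filter⁺ (irreducible? n) (vectors-complete n c) (irreducible-to-Fin n c (sound c c∈)))
        (λ {c} c∈ → complete c (irreducible-to-F n c (proj₂ (∈-filter⁻ (irreducible? n) {xs = vectors n} c∈)))))

module GaussToValuation where

  open import Defs using (Valuation)
  open Valuations
  open DivisorSums
  open import Data.Nat
  open import Data.Nat.Properties
  open import Data.Nat.Divisibility
  open import Data.Nat.Primality
  open import Data.Product using (_,_)
  open import Data.Sum using (inj₁; inj₂)
  open import Data.Empty using (⊥-elim)
  open import Relation.Nullary using (¬_)
  open import Relation.Binary.PropositionalEquality
  open ≡-Reasoning

  pow-double : ∀ q m → q ^ (2 * m) ≡ q ^ m * q ^ m
  pow-double q m = trans (cong (q ^_) (cong (m +_) (+-identityʳ m))) (^-distribˡ-+-* q m m)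

  odd-prime-odd : ∀ {ℓ} → Prime ℓ → ℓ ≢ 2 → ¬ 2 ∣ ℓ
  odd-prime-odd pℓ ℓ≢2 2∣ℓ with prime⇒irreducible pℓ 2∣ℓ
  ... | inj₁ ()
  ... | inj₂ 2≡ℓ = ℓ≢2 (sym 2≡ℓ)

  gauss⇒valuation : ∀ q ℓ → Prime ℓ → ℓ ≢ 2 → ℓ ∣ q ∸ 1 → ∀ t e N →
    Valuation ℓ (q ∸ 1) e → GaussFormula q N → Valuation ℓ (N (2 ^ t * ℓ)) (e ∸ 1)
  gauss⇒valuation zero ℓ _ _ _ t e N (_ , ℓ^e+1∤0) _ = ⊥-elim (ℓ^e+1∤0 (_∣0 (ℓ ^ suc e)))
  gauss⇒valuation (suc y) ℓ pℓ ℓ≢2 ℓ∣y zero e N vy gauss =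
    subst (λ m → Valuation ℓ (N m) (e ∸ 1)) (sym (*-identityˡ ℓ))
      (val-from-ℓ-identity {e = e} pℓ (nearOne y refl ℓ∣y vy) (gauss-at-prime N gauss pℓ))
  gauss⇒valuation (suc y) ℓ pℓ ℓ≢2 ℓ∣y (suc t) e N vy gauss =
    val-from-2ℓ-identity pℓ b≈1 (odd-prime∤2^ pℓ ℓ≢2 (suc t)) identity
    where
    q = suc y
    T = 2 ^ t
    n = 2 * T * ℓ
    b = q ^ T
    b≈1 : NearOne ℓ e b
    b≈1 = lift-exponent {e = e} T pℓ (odd-prime∤2^ pℓ ℓ≢2 t) (nearOne y refl ℓ∣y vy)
    q^Tℓ≡ : q ^ (T * ℓ) ≡ b ^ ℓ
    q^Tℓ≡ = sym (^-*-assoc q T ℓ)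
    identity : n * N n + b ^ ℓ + b * b ≡ b ^ ℓ * b ^ ℓ + b
    identity = begin
      n * N n + b ^ ℓ + b * b
        ≡⟨ sym (cong₂ (λ x z → n * N n + x + z) q^Tℓ≡ (pow-double q T)) ⟩
      n * N n + q ^ (T * ℓ) + q ^ (2 * T)
        ≡⟨ gauss-at-2Tℓ t N gauss pℓ (odd-prime-odd pℓ ℓ≢2) ⟩
      q ^ n + b
        ≡⟨ cong (_+ b) (trans (cong (q ^_) (*-assoc 2 T ℓ)) (pow-double q (T * ℓ))) ⟩
      q ^ (T * ℓ) * q ^ (T * ℓ) + b
        ≡⟨ cong (λ x → x * x + b) q^Tℓ≡ ⟩
      b ^ ℓ * b ^ ℓ + b ∎

open import Defs
open import Data.Nat using (ℕ; _∸_; _*_; _^_)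
open import Data.Nat.Divisibility using (_∣_)
open import Data.Nat.Primality using (Prime)
open import Relation.Binary.PropositionalEquality using (_≢_)
import Relation.Binary.PropositionalEquality as ≡
open DivisorSums using (GaussFormula; counting⇒gauss)
open GaussToValuation using (gauss⇒valuation)
open Fields using (module FromFiniteField)
open StatementPolynomials using (module Compare)

gauss-formula : ∀ {q} (F : FiniteField q) → let open FromFiniteField F in
  GaussFormula q (Counting.N discreteField enumeration)
gauss-formula {q} F = ≡.subst (λ s → GaussFormula s N) enumeration-length (counting⇒gauss _ N weighted-count)
  where
  open FromFiniteField F
  open Counting discreteField enumeration using (N; weighted-count)

lemma5p2 : (q ℓ : ℕ) → (F : FiniteField q) → Prime ℓ → ℓ ≢ 2 → ℓ ∣ (q ∸ 1) →
    (t e N : ℕ) → Valuation ℓ (q ∸ 1) e →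
    Poly.CountsIrreducible F (2 ^ t * ℓ) N →
    Valuation ℓ N (e ∸ 1)
lemma5p2 q ℓ F pℓ ℓ≢2 ℓ∣q-1 t e N v[q-1]≡e counts =
  ≡.subst (λ M → Valuation ℓ M (e ∸ 1)) (≡.sym (count≡N (2 ^ t * ℓ) N counts))
    (gauss⇒valuation q ℓ pℓ ℓ≢2 ℓ∣q-1 t e _ v[q-1]≡e (gauss-formula F))
  where open Compare F
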